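{- Let $n\ge 1$, let $G_1,\dots,G_n$ be rooted graphs with root of $G_i$ denoted $i$, and let $G$ be the rooted product of the path $P_n$ (vertices $1,\dots,n$ in order) with $G_1,\dots,G_n$, i.e. the disjoint union of the $G_i$ together with the edges $\{i,i+1\}$, $1\le i\le n-1$. Assume that $\alpha^{G_i}_i = \alpha^{G_{n+1-i}}_{n+1-i}$ for all $i \in \{1,\dots,n\}$. Then $\alpha^G_1 = \alpha^G_n$.
   Context: All graphs are finite and simple. $\phi^H$ denotes the characteristic polynomial of the adjacency matrix of a graph $H$, and for a vertex $v$ of $H$, $\alpha^H_v = \phi^H/\phi^{H\setminus v}$ is a rational function in $x$. -}

module Defs where

open import Data.Nat using (ℕ; zero; suc) renaming (_+_ to _+ℕ_)
open import Data.Integer as ℤ using (ℤ; +_; -[1+_])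
open import Data.List using (List; []; _∷_; map)
open import Data.Fin using (Fin; zero; suc; punchIn; splitAt; _↑ˡ_; _↑ʳ_; opposite; _≟_)
open import Data.Sum using (_⊎_; inj₁; inj₂)
open import Data.Bool using (Bool; true; false; if_then_else_; _∧_)
open import Relation.Nullary.Decidable using (⌊_⌋)
open import Relation.Binary.PropositionalEquality using (_≡_; refl)

-- Polynomials in ℤ[x]: coefficient lists, lowest degree first.

Poly : Set
Poly = List ℤ

infixl 6 _+P_
infixl 7 _*P_

_+P_ : Poly → Poly → Poly
[]      +P q       = q
(a ∷ p) +P []      = a ∷ p
(a ∷ p) +P (b ∷ q) = (a ℤ.+ b) ∷ (p +P q)

scaleP : ℤ → Poly → Poly
scaleP c p = map (c ℤ.*_) p

negP : Poly → Poly
negP = scaleP (ℤ.- (+ 1))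

_*P_ : Poly → Poly → Poly
[]      *P q = []
(a ∷ p) *P q = scaleP a q +P (+ 0 ∷ (p *P q))

coeff : Poly → ℕ → ℤ
coeff []      i       = + 0
coeff (a ∷ p) zero    = a
coeff (a ∷ p) (suc i) = coeff p i

infix 4 _≈P_
_≈P_ : Poly → Poly → Set
p ≈P q = ∀ i → coeff p i ≡ coeff q i

oneP : Poly
oneP = + 1 ∷ []

xP : Poly
xP = + 0 ∷ + 1 ∷ []

sumP : (n : ℕ) → (Fin n → Poly) → Poly
sumP zero    f = []
sumP (suc n) f = f zero +P sumP n (λ j → f (suc j))

signP : ℕ → Poly → Poly
signP zero    p = p
signP (suc k) p = negP (signP k p)

det : (n : ℕ) → (Fin n → Fin n → Poly) → Poly
det zero    M = oneP
det (suc n) M =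
  sumP (suc n) (λ j → signP (Data.Fin.toℕ j)
    (M zero j *P det n (λ r c → M (suc r) (punchIn j c))))

record Graph (m : ℕ) : Set where
  field
    adj    : Fin m → Fin m → Bool
    sym    : ∀ u v → adj u v ≡ adj v u
    irrefl : ∀ u → adj u u ≡ false
open Graph public

φ : ∀ {m} → Graph m → Poly
φ {m} H = det m (λ i j →
  if ⌊ i ≟ j ⌋ then xP else (if adj H i j then negP oneP else []))

del : ∀ {k} → Graph (suc k) → Fin (suc k) → Graph k
del H v = record
  { adj    = λ a b → adj H (punchIn v a) (punchIn v b)
  ; sym    = λ a b → sym H (punchIn v a) (punchIn v b)
  ; irrefl = λ a → irrefl H (punchIn v a)
  }

-- Equality of rational functions α^H_v = φ^H / φ^{H∖v} and α^K_w = φ^K / φ^{K∖w}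
-- in ℚ(x) (denominators are monic, hence nonzero): cross-multiplication.
αEq : ∀ {a b} → Graph (suc a) → Fin (suc a) → Graph (suc b) → Fin (suc b) → Set
αEq H v K w = φ H *P φ (del K w) ≈P φ K *P φ (del H v)

record RootedGraph : Set where
  field
    pred  : ℕ
    graph : Graph (suc pred)
    root  : Fin (suc pred)
open RootedGraph public

-- Rooted product of the path P_{m+1} with G_0,…,G_m (0-indexed):
-- disjoint union of the G_i plus the edges {root G_i, root G_{i+1}}.
-- Built recursively: G_0 glued to the product of G_1,…,G_m.
-- 'first' is the vertex corresponding to path vertex 1 (root of G_0),
-- 'last' the one corresponding to path vertex n (root of G_m).

record Chain : Set where
  field
    cpred  : ℕ
    cgraph : Graph (suc cpred)
    first  : Fin (suc cpred)
    last   : Fin (suc cpred)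

private
  blk : ∀ {a b} → Graph a → Fin a → Graph b → Fin b →
        Fin a ⊎ Fin b → Fin a ⊎ Fin b → Bool
  blk H r C f (inj₁ x) (inj₁ y) = adj H x y
  blk H r C f (inj₂ x) (inj₂ y) = adj C x y
  blk H r C f (inj₁ x) (inj₂ y) = ⌊ x ≟ r ⌋ ∧ ⌊ y ≟ f ⌋
  blk H r C f (inj₂ y) (inj₁ x) = ⌊ x ≟ r ⌋ ∧ ⌊ y ≟ f ⌋

  blk-sym : ∀ {a b} (H : Graph a) r (C : Graph b) f s t →
            blk H r C f s t ≡ blk H r C f t s
  blk-sym H r C f (inj₁ x) (inj₁ y) = sym H x y
  blk-sym H r C f (inj₂ x) (inj₂ y) = sym C x y
  blk-sym H r C f (inj₁ x) (inj₂ y) = refl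
  blk-sym H r C f (inj₂ y) (inj₁ x) = refl

  blk-irr : ∀ {a b} (H : Graph a) r (C : Graph b) f s → blk H r C f s s ≡ false
  blk-irr H r C f (inj₁ x) = irrefl H x
  blk-irr H r C f (inj₂ x) = irrefl C x

glue : ∀ {a b} → Graph a → Fin a → Graph b → Fin b → Graph (a +ℕ b)
glue {a} H r C f = record
  { adj    = λ u v → blk H r C f (splitAt a u) (splitAt a v)
  ; sym    = λ u v → blk-sym H r C f (splitAt a u) (splitAt a v)
  ; irrefl = λ u → blk-irr H r C f (splitAt a u)
  }

rootedProduct : (m : ℕ) → (Fin (suc m) → RootedGraph) → Chain
rootedProduct zero Gs = record
  { cpred = pred (Gs zero) ; cgraph = graph (Gs zero)
  ; first = root (Gs zero) ; last = root (Gs zero) }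
rootedProduct (suc m) Gs =
  let H = Gs zero
      C = rootedProduct m (λ i → Gs (suc i))
  in record
  { cpred  = pred H +ℕ suc (Chain.cpred C)
  ; cgraph = glue (graph H) (root H) (Chain.cgraph C) (Chain.first C)
  ; first  = root H ↑ˡ suc (Chain.cpred C)
  ; last   = suc (pred H) ↑ʳ Chain.last C
  }

-- Expanding det (xI − A) along the bridge of the graph glued from H and C by an edge r–f gives
-- φ = φ H · φ C − φ(H ∖ r) · φ(C ∖ f). Hence, writing (Pᵢ, Qᵢ) = (φ^{Gᵢ}, φ^{Gᵢ ∖ i}), the
-- rooted product G has φ^G = K(1..n), the continuant of these pairs, and φ^{G ∖ 1} = Q₁ K(2..n).
-- Deleting vertex n instead turns G into the rooted product in which Gₙ₋₁, Gₙ are replaced by the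
-- single factor Gₙ₋₁ ⊕ (Gₙ ∖ n), and this gives φ^{G ∖ n} = Qₙ K(1..n−1). The hypothesis
-- Pᵢ Qₙ₊₁₋ᵢ = Pₙ₊₁₋ᵢ Qᵢ yields Q₁ K(2..n) = Qₙ K(1..n−1) by induction peeling both ends of the
-- continuant, so φ^{G ∖ 1} = φ^{G ∖ n}, and α^G_1 = α^G_n.

module Submission where

open import Defs hiding (sym)
import Defs
open import Algebra.Bundles using (CommutativeRing)
open import Data.Bool using (Bool; true; false; if_then_else_; _∧_; not)
open import Data.Bool.Properties using (∧-zeroʳ)
open import Data.Empty using (⊥; ⊥-elim)
open import Data.Fin using (Fin; zero; suc; toℕ; punchIn; punchOut; _↑ˡ_; _↑ʳ_; cast; splitAt; _≟_; inject₁; fromℕ; opposite)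
import Data.Fin.Properties as FinP
open import Data.Integer as ℤ using (ℤ; 0ℤ; 1ℤ; -1ℤ)
import Data.Integer.Properties as ℤP
open import Data.Integer.Tactic.RingSolver using () renaming (solve-∀ to solve-ℤ)
open import Data.List using ([]; _∷_)
open import Data.Maybe using (nothing)
open import Data.Nat using (ℕ; zero; suc; _+_; _∸_; _<_; _≤_; s≤s; z≤n; _<?_)
import Data.Nat.Properties as ℕP
open import Data.Nat.Tactic.RingSolver using () renaming (solve-∀ to solve-ℕ)
open import Data.Product using (_×_; _,_; proj₁; proj₂)
open import Data.Sum using (_⊎_; inj₁; inj₂)
open import Data.Vec.Functional using (Vector; tail; init; last)
open import Function using (_∘_)
open import Relation.Binary.PropositionalEquality
import Relation.Binary.Reasoning.Setoid as SetoidReasoning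
open import Relation.Nullary using (¬_; Dec; yes; no; does)
open import Relation.Nullary.Decidable using (⌊_⌋; isYes≗does; dec-true; dec-false)
open import Relation.Unary using (Pred; Decidable)
open import Relation.Unary.Properties using (∁?)
open import Tactic.RingSolver using (solve-∀)
open import Tactic.RingSolver.Core.AlmostCommutativeRing using (AlmostCommutativeRing; fromCommutativeRing)

-- The ring ℤ[x]

headP : Poly → ℤ
headP p = coeff p 0

tailP : Poly → Poly
tailP []      = []
tailP (a ∷ p) = p

coeff-tailP : ∀ p i → coeff p (suc i) ≡ coeff (tailP p) i
coeff-tailP []      i = refl
coeff-tailP (a ∷ p) i = refl

coeff-+P : ∀ p q i → coeff (p +P q) i ≡ coeff p i ℤ.+ coeff q i
coeff-+P []      q       i       = sym (ℤP.+-identityˡ _)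
coeff-+P (a ∷ p) []      i       = sym (ℤP.+-identityʳ _)
coeff-+P (a ∷ p) (b ∷ q) zero    = refl
coeff-+P (a ∷ p) (b ∷ q) (suc i) = coeff-+P p q i

coeff-scaleP : ∀ c p i → coeff (scaleP c p) i ≡ c ℤ.* coeff p i
coeff-scaleP c []      i       = sym (ℤP.*-zeroʳ c)
coeff-scaleP c (a ∷ p) zero    = refl
coeff-scaleP c (a ∷ p) (suc i) = coeff-scaleP c p i

coeff-negP : ∀ p i → coeff (negP p) i ≡ ℤ.- coeff p i
coeff-negP p i = trans (coeff-scaleP -1ℤ p i) (ℤP.-1*i≡-i (coeff p i))

coeff-*P-zero : ∀ p q → coeff (p *P q) 0 ≡ headP p ℤ.* headP q
coeff-*P-zero []      q = refl
coeff-*P-zero (a ∷ p) q = trans (coeff-+P (scaleP a q) _ 0)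
  (trans (ℤP.+-identityʳ _) (coeff-scaleP a q 0))

coeff-*P-suc : ∀ p q i →
  coeff (p *P q) (suc i) ≡ headP p ℤ.* coeff q (suc i) ℤ.+ coeff (tailP p *P q) i
coeff-*P-suc []      q i = refl
coeff-*P-suc (a ∷ p) q i =
  trans (coeff-+P (scaleP a q) _ (suc i)) (cong (ℤ._+ coeff (p *P q) i) (coeff-scaleP a q (suc i)))

-- A record rather than _≈P_ itself, so that Agda can infer p and q from a proof of p ≈ q.
infix 4 _≈_
record _≈_ (p q : Poly) : Set where
  constructor mk≈
  field coeff-≈ : p ≈P q
open _≈_

≈-refl : ∀ {p} → p ≈ p
≈-refl = mk≈ λ _ → refl

≈-sym : ∀ {p q} → p ≈ q → q ≈ p
≈-sym (mk≈ e) = mk≈ λ i → sym (e i)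

≈-trans : ∀ {p q r} → p ≈ q → q ≈ r → p ≈ r
≈-trans (mk≈ e) (mk≈ f) = mk≈ λ i → trans (e i) (f i)

≈-reflexive : ∀ {p q} → p ≡ q → p ≈ q
≈-reflexive refl = ≈-refl

+P-cong : ∀ {p p′ q q′} → p ≈ p′ → q ≈ q′ → p +P q ≈ p′ +P q′
+P-cong {p} {p′} {q} {q′} (mk≈ e) (mk≈ f) = mk≈ λ i →
  trans (coeff-+P p q i) (trans (cong₂ ℤ._+_ (e i) (f i)) (sym (coeff-+P p′ q′ i)))

+P-congˡ : ∀ p {q q′} → q ≈ q′ → p +P q ≈ p +P q′
+P-congˡ p = +P-cong ≈-refl

+P-congʳ : ∀ q {p p′} → p ≈ p′ → p +P q ≈ p′ +P q
+P-congʳ q e = +P-cong e ≈-refl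

scaleP-cong : ∀ c {p q} → p ≈ q → scaleP c p ≈ scaleP c q
scaleP-cong c {p} {q} (mk≈ e) = mk≈ λ i →
  trans (coeff-scaleP c p i) (trans (cong (c ℤ.*_) (e i)) (sym (coeff-scaleP c q i)))

∷-cong : ∀ a {p q} → p ≈ q → a ∷ p ≈ a ∷ q
∷-cong a (mk≈ e) = mk≈ λ { zero → refl ; (suc i) → e i }

tailP-cong : ∀ {p q} → p ≈ q → tailP p ≈ tailP q
tailP-cong {p} {q} (mk≈ e) = mk≈ λ i → trans (sym (coeff-tailP p i)) (trans (e (suc i)) (coeff-tailP q i))

*P-congʳ : ∀ q {p p′} → p ≈ p′ → p *P q ≈ p′ *P q
*P-congʳ q {p} {p′} e = mk≈ (go p p′ e)
  where
  go : ∀ p p′ → p ≈ p′ → ∀ i → coeff (p *P q) i ≡ coeff (p′ *P q) i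
  go p p′ e zero = trans (coeff-*P-zero p q)
    (trans (cong (ℤ._* headP q) (coeff-≈ e 0)) (sym (coeff-*P-zero p′ q)))
  go p p′ e (suc i) = trans (coeff-*P-suc p q i)
    (trans (cong₂ ℤ._+_ (cong (ℤ._* coeff q (suc i)) (coeff-≈ e 0)) (go (tailP p) (tailP p′) (tailP-cong e) i))
           (sym (coeff-*P-suc p′ q i)))

*P-congˡ : ∀ p {q q′} → q ≈ q′ → p *P q ≈ p *P q′
*P-congˡ []      e = ≈-refl
*P-congˡ (a ∷ p) e = +P-cong (scaleP-cong a e) (∷-cong 0ℤ (*P-congˡ p e))

*P-cong : ∀ {p p′ q q′} → p ≈ p′ → q ≈ q′ → p *P q ≈ p′ *P q′
*P-cong {p′ = p′} {q = q} e f = ≈-trans (*P-congʳ q e) (*P-congˡ p′ f)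

+P-comm : ∀ p q → p +P q ≈ q +P p
+P-comm p q = mk≈ λ i →
  trans (coeff-+P p q i) (trans (ℤP.+-comm (coeff p i) (coeff q i)) (sym (coeff-+P q p i)))

+P-assoc : ∀ p q r → (p +P q) +P r ≈ p +P (q +P r)
+P-assoc p q r = mk≈ λ i → begin
  coeff ((p +P q) +P r) i                   ≡⟨ coeff-+P (p +P q) r i ⟩
  coeff (p +P q) i ℤ.+ coeff r i            ≡⟨ cong (ℤ._+ coeff r i) (coeff-+P p q i) ⟩
  coeff p i ℤ.+ coeff q i ℤ.+ coeff r i     ≡⟨ ℤP.+-assoc (coeff p i) _ _ ⟩
  coeff p i ℤ.+ (coeff q i ℤ.+ coeff r i)   ≡⟨ cong (ℤ._+_ (coeff p i)) (coeff-+P q r i) ⟨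
  coeff p i ℤ.+ coeff (q +P r) i            ≡⟨ coeff-+P p (q +P r) i ⟨
  coeff (p +P (q +P r)) i                   ∎
  where open ≡-Reasoning

+P-identityʳ : ∀ p → p +P [] ≈ p
+P-identityʳ p = mk≈ λ i → trans (coeff-+P p [] i) (ℤP.+-identityʳ (coeff p i))

negP-inverseʳ : ∀ p → p +P negP p ≈ []
negP-inverseʳ p = mk≈ λ i →
  trans (coeff-+P p _ i) (trans (cong (ℤ._+_ (coeff p i)) (coeff-negP p i)) (ℤP.+-inverseʳ (coeff p i)))

tailP-+P : ∀ p q → tailP (p +P q) ≈ tailP p +P tailP q
tailP-+P p q = mk≈ λ j → trans (sym (coeff-tailP (p +P q) j)) (trans (coeff-+P p q (suc j))
  (trans (cong₂ ℤ._+_ (coeff-tailP p j) (coeff-tailP q j)) (sym (coeff-+P (tailP p) (tailP q) j))))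

*P-distribʳ-+P : ∀ r p q → (p +P q) *P r ≈ p *P r +P q *P r
*P-distribʳ-+P r p q = mk≈ (go p q)
  where
  expand : ∀ (a b c d e : ℤ) → (a ℤ.+ b) ℤ.* c ℤ.+ (d ℤ.+ e) ≡ (a ℤ.* c ℤ.+ d) ℤ.+ (b ℤ.* c ℤ.+ e)
  expand = solve-ℤ
  go : ∀ p q i → coeff ((p +P q) *P r) i ≡ coeff (p *P r +P q *P r) i
  go p q zero = trans (coeff-*P-zero (p +P q) r) (trans (cong (ℤ._* headP r) (coeff-+P p q 0))
    (trans (ℤP.*-distribʳ-+ (headP r) (headP p) (headP q))
    (sym (trans (coeff-+P (p *P r) _ 0) (cong₂ ℤ._+_ (coeff-*P-zero p r) (coeff-*P-zero q r))))))
  go p q (suc i) = trans (coeff-*P-suc (p +P q) r i) (trans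
    (cong₂ ℤ._+_ (cong (ℤ._* coeff r (suc i)) (coeff-+P p q 0))
      (trans (coeff-≈ (*P-congʳ r (tailP-+P p q)) i) (go (tailP p) (tailP q) i)))
    (trans (trans (cong (ℤ._+_ ((headP p ℤ.+ headP q) ℤ.* coeff r (suc i))) (coeff-+P (tailP p *P r) (tailP q *P r) i))
                  (expand (headP p) (headP q) (coeff r (suc i)) _ _))
    (sym (trans (coeff-+P (p *P r) _ (suc i)) (cong₂ ℤ._+_ (coeff-*P-suc p r i) (coeff-*P-suc q r i))))))

*P-comm : ∀ p q → p *P q ≈ q *P p
*P-comm p q = mk≈ λ i → go i p q
  where
  swap₁ : ∀ (a b c d : ℤ) → a ℤ.* b ℤ.+ c ℤ.* d ≡ d ℤ.* c ℤ.+ b ℤ.* a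
  swap₁ = solve-ℤ
  swap₂ : ∀ (a b c d e : ℤ) → a ℤ.* b ℤ.+ (c ℤ.* d ℤ.+ e) ≡ c ℤ.* d ℤ.+ (a ℤ.* b ℤ.+ e)
  swap₂ = solve-ℤ
  go : ∀ i p q → coeff (p *P q) i ≡ coeff (q *P p) i
  go zero p q = trans (coeff-*P-zero p q) (trans (ℤP.*-comm (headP p) (headP q)) (sym (coeff-*P-zero q p)))
  go (suc zero) p q =
    trans (coeff-*P-suc p q 0) (trans (cong₂ ℤ._+_ (cong (headP p ℤ.*_) (coeff-tailP q 0)) (coeff-*P-zero (tailP p) q))
    (trans (swap₁ (headP p) (headP (tailP q)) (headP (tailP p)) (headP q))
    (sym (trans (coeff-*P-suc q p 0) (cong₂ ℤ._+_ (cong (headP q ℤ.*_) (coeff-tailP p 0)) (coeff-*P-zero (tailP q) p))))))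
  go (suc (suc i)) p q =
    let e₁ : coeff (tailP p *P q) (suc i) ≡ headP q ℤ.* coeff p (suc (suc i)) ℤ.+ coeff (tailP q *P tailP p) i
        e₁ = trans (go (suc i) (tailP p) q) (trans (coeff-*P-suc q (tailP p) i)
               (cong (ℤ._+ coeff (tailP q *P tailP p) i) (cong (headP q ℤ.*_) (sym (coeff-tailP p (suc i))))))
        e₂ : coeff (tailP q *P p) (suc i) ≡ headP p ℤ.* coeff q (suc (suc i)) ℤ.+ coeff (tailP q *P tailP p) i
        e₂ = trans (go (suc i) (tailP q) p) (trans (coeff-*P-suc p (tailP q) i)
               (cong₂ ℤ._+_ (cong (headP p ℤ.*_) (sym (coeff-tailP q (suc i)))) (go i (tailP p) (tailP q))))
    in trans (coeff-*P-suc p q (suc i)) (trans (cong (ℤ._+_ (headP p ℤ.* coeff q (suc (suc i)))) e₁)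
       (trans (swap₂ (headP p) (coeff q (suc (suc i))) (headP q) (coeff p (suc (suc i))) (coeff (tailP q *P tailP p) i))
       (sym (trans (coeff-*P-suc q p (suc i)) (cong (ℤ._+_ (headP q ℤ.* coeff p (suc (suc i)))) e₂)))))

*P-identityˡ : ∀ q → oneP *P q ≈ q
*P-identityˡ q = mk≈ λ i → begin
  coeff (oneP *P q) i                           ≡⟨ coeff-+P (scaleP 1ℤ q) (0ℤ ∷ []) i ⟩
  coeff (scaleP 1ℤ q) i ℤ.+ coeff (0ℤ ∷ []) i   ≡⟨ cong₂ ℤ._+_ (coeff-scaleP 1ℤ q i) (coeff-zero i) ⟩
  1ℤ ℤ.* coeff q i ℤ.+ 0ℤ                       ≡⟨ ℤP.+-identityʳ _ ⟩
  1ℤ ℤ.* coeff q i                              ≡⟨ ℤP.*-identityˡ (coeff q i) ⟩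
  coeff q i                                     ∎
  where
  open ≡-Reasoning
  coeff-zero : ∀ i → coeff (0ℤ ∷ []) i ≡ 0ℤ
  coeff-zero zero    = refl
  coeff-zero (suc i) = refl

*P-identityʳ : ∀ q → q *P oneP ≈ q
*P-identityʳ q = ≈-trans (*P-comm q oneP) (*P-identityˡ q)

tailP-scaleP : ∀ c p → tailP (scaleP c p) ≡ scaleP c (tailP p)
tailP-scaleP c []      = refl
tailP-scaleP c (a ∷ p) = refl

scaleP-*P : ∀ c p r → scaleP c p *P r ≈ scaleP c (p *P r)
scaleP-*P c p r = mk≈ (λ i → go i p)
  where
  factor : ∀ (a b c d : ℤ) → a ℤ.* b ℤ.* c ℤ.+ a ℤ.* d ≡ a ℤ.* (b ℤ.* c ℤ.+ d)
  factor = solve-ℤ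
  go : ∀ i p → coeff (scaleP c p *P r) i ≡ coeff (scaleP c (p *P r)) i
  go zero p = trans (coeff-*P-zero (scaleP c p) r) (trans (cong (ℤ._* headP r) (coeff-scaleP c p 0))
    (trans (ℤP.*-assoc c (headP p) (headP r)) (sym (trans (coeff-scaleP c (p *P r) 0) (cong (c ℤ.*_) (coeff-*P-zero p r))))))
  go (suc i) p = trans (coeff-*P-suc (scaleP c p) r i)
    (trans (cong₂ ℤ._+_ (cong (ℤ._* coeff r (suc i)) (coeff-scaleP c p 0))
       (trans (cong (λ s → coeff (s *P r) i) (tailP-scaleP c p)) (go i (tailP p))))
    (trans (trans (cong (ℤ._+_ (c ℤ.* headP p ℤ.* coeff r (suc i))) (coeff-scaleP c (tailP p *P r) i))
                  (factor c (headP p) (coeff r (suc i)) (coeff (tailP p *P r) i)))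
    (sym (trans (coeff-scaleP c (p *P r) (suc i)) (cong (c ℤ.*_) (coeff-*P-suc p r i))))))

tailP-*P : ∀ p q → tailP (p *P q) ≈ scaleP (headP p) (tailP q) +P tailP p *P q
tailP-*P p q = mk≈ λ j → trans (sym (coeff-tailP (p *P q) j)) (trans (coeff-*P-suc p q j)
  (trans (cong (ℤ._+ coeff (tailP p *P q) j) (cong (headP p ℤ.*_) (coeff-tailP q j)))
  (sym (trans (coeff-+P (scaleP (headP p) (tailP q)) (tailP p *P q) j)
              (cong (ℤ._+ coeff (tailP p *P q) j) (coeff-scaleP (headP p) (tailP q) j))))))

*P-assoc : ∀ p q r → (p *P q) *P r ≈ p *P (q *P r)
*P-assoc p q r = mk≈ λ i → go i p
  where
  regroup : ∀ (a b c d e : ℤ) → a ℤ.* b ℤ.* c ℤ.+ (a ℤ.* d ℤ.+ e) ≡ a ℤ.* (b ℤ.* c ℤ.+ d) ℤ.+ e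
  regroup = solve-ℤ
  go : ∀ i p → coeff ((p *P q) *P r) i ≡ coeff (p *P (q *P r)) i
  go zero p = trans (coeff-*P-zero (p *P q) r) (trans (cong (ℤ._* headP r) (coeff-*P-zero p q))
    (trans (ℤP.*-assoc (headP p) (headP q) (headP r)) (sym (trans (coeff-*P-zero p (q *P r)) (cong (headP p ℤ.*_) (coeff-*P-zero q r))))))
  go (suc i) p =
    trans (coeff-*P-suc (p *P q) r i) (trans (cong₂ ℤ._+_ (cong (ℤ._* coeff r (suc i)) (coeff-*P-zero p q)) tail≡)
    (trans (regroup (headP p) (headP q) (coeff r (suc i)) X Y)
    (sym (trans (coeff-*P-suc p (q *P r) i) (cong (ℤ._+ Y) (cong (headP p ℤ.*_) (coeff-*P-suc q r i)))))))
    where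
    X = coeff (tailP q *P r) i
    Y = coeff (tailP p *P (q *P r)) i
    tail≡ : coeff (tailP (p *P q) *P r) i ≡ headP p ℤ.* X ℤ.+ Y
    tail≡ = trans (coeff-≈ (*P-congʳ r (tailP-*P p q)) i)
      (trans (coeff-≈ (*P-distribʳ-+P r (scaleP (headP p) (tailP q)) (tailP p *P q)) i)
      (trans (coeff-+P (scaleP (headP p) (tailP q) *P r) ((tailP p *P q) *P r) i)
      (cong₂ ℤ._+_ (trans (coeff-≈ (scaleP-*P (headP p) (tailP q) r) i) (coeff-scaleP (headP p) (tailP q *P r) i))
                  (go i (tailP p)))))

*P-distribˡ-+P : ∀ r p q → r *P (p +P q) ≈ r *P p +P r *P q
*P-distribˡ-+P r p q = ≈-trans (*P-comm r (p +P q))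
  (≈-trans (*P-distribʳ-+P r p q) (+P-cong (*P-comm p r) (*P-comm q r)))

negP-cong : ∀ {p q} → p ≈ q → negP p ≈ negP q
negP-cong = scaleP-cong -1ℤ

ℤ[x] : CommutativeRing _ _
ℤ[x] = record
  { Carrier = Poly ; _≈_ = _≈_ ; _+_ = _+P_ ; _*_ = _*P_ ; -_ = negP ; 0# = [] ; 1# = oneP
  ; isCommutativeRing = record
    { isRing = record
      { +-isAbelianGroup = record
        { isGroup = record
          { isMonoid = record
            { isSemigroup = record
              { isMagma = record
                { isEquivalence = record { refl = ≈-refl ; sym = ≈-sym ; trans = ≈-trans }
                ; ∙-cong = +P-cong }
              ; assoc = +P-assoc }
            ; identity = (λ _ → ≈-refl) , +P-identityʳ }
          ; inverse = (λ p → ≈-trans (+P-comm (negP p) p) (negP-inverseʳ p)) , negP-inverseʳ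
          ; ⁻¹-cong = negP-cong }
        ; comm = +P-comm }
      ; *-cong = *P-cong
      ; *-assoc = *P-assoc
      ; *-identity = *P-identityˡ , *P-identityʳ
      ; distrib = *P-distribˡ-+P , *P-distribʳ-+P }
    ; *-comm = *P-comm } }

-- Without a zero test the solver merely skips some simplifications.
ℤ[x]-almost : AlmostCommutativeRing _ _
ℤ[x]-almost = fromCommutativeRing ℤ[x] (λ _ → nothing)

-- Determinants

Mat : ℕ → Set
Mat n = Fin n → Fin n → Poly

minor : ∀ {n} → Mat (suc n) → Fin (suc n) → Fin (suc n) → Mat n
minor M i j r c = M (punchIn i r) (punchIn j c)

sumP-cong : ∀ n {f g : Fin n → Poly} → (∀ j → f j ≈ g j) → sumP n f ≈ sumP n g
sumP-cong zero    e = ≈-refl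
sumP-cong (suc n) e = +P-cong (e zero) (sumP-cong n (e ∘ suc))

sumP-zero : ∀ n {f : Fin n → Poly} → (∀ j → f j ≈ []) → sumP n f ≈ []
sumP-zero zero    e = ≈-refl
sumP-zero (suc n) e = +P-cong (e zero) (sumP-zero n (e ∘ suc))

sumP-+P : ∀ n (f g : Fin n → Poly) → sumP n (λ j → f j +P g j) ≈ sumP n f +P sumP n g
sumP-+P zero    f g = ≈-refl
sumP-+P (suc n) f g =
  ≈-trans (+P-congˡ (f zero +P g zero) (sumP-+P n (f ∘ suc) (g ∘ suc)))
          (interchange (f zero) (g zero) (sumP n (f ∘ suc)) (sumP n (g ∘ suc)))
  where
  interchange : ∀ a b c d → (a +P b) +P (c +P d) ≈ (a +P c) +P (b +P d)
  interchange = solve-∀ ℤ[x]-almost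

sumP-*Pˡ : ∀ n p (f : Fin n → Poly) → p *P sumP n f ≈ sumP n (λ j → p *P f j)
sumP-*Pˡ zero    p f = *P-comm p []
sumP-*Pˡ (suc n) p f =
  ≈-trans (*P-distribˡ-+P p (f zero) (sumP n (f ∘ suc))) (+P-congˡ (p *P f zero) (sumP-*Pˡ n p (f ∘ suc)))

sumP-*Pʳ : ∀ n p (f : Fin n → Poly) → sumP n f *P p ≈ sumP n (λ j → f j *P p)
sumP-*Pʳ n p f = ≈-trans (*P-comm (sumP n f) p)
  (≈-trans (sumP-*Pˡ n p f) (sumP-cong n (λ j → *P-comm p (f j))))

sumP-punchIn : ∀ n (f : Fin (suc n) → Poly) k → sumP (suc n) f ≈ f k +P sumP n (f ∘ punchIn k)
sumP-punchIn n       f zero    = ≈-refl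
sumP-punchIn (suc n) f (suc k) =
  ≈-trans (+P-congˡ (f zero) (sumP-punchIn n (f ∘ suc) k))
          (left-comm (f zero) (f (suc k)) (sumP n (f ∘ suc ∘ punchIn k)))
  where
  left-comm : ∀ a b c → a +P (b +P c) ≈ b +P (a +P c)
  left-comm = solve-∀ ℤ[x]-almost

sumP-single : ∀ n (f : Fin (suc n) → Poly) k → (∀ j → j ≢ k → f j ≈ []) → sumP (suc n) f ≈ f k
sumP-single n f k z =
  ≈-trans (sumP-punchIn n f k)
  (≈-trans (+P-congˡ (f k) (sumP-zero n (λ j → z (punchIn k j) (FinP.punchInᵢ≢i k j))))
           (+P-identityʳ (f k)))

sumP-↑ : ∀ a b (f : Fin (a + b) → Poly) →
  sumP (a + b) f ≈ sumP a (λ i → f (i ↑ˡ b)) +P sumP b (λ j → f (a ↑ʳ j))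
sumP-↑ zero    b f = ≈-refl
sumP-↑ (suc a) b f =
  ≈-trans (+P-congˡ (f zero) (sumP-↑ a b (f ∘ suc)))
          (≈-sym (+P-assoc (f zero) (sumP a (λ i → f (suc i ↑ˡ b))) (sumP b (λ j → f (suc a ↑ʳ j)))))

signP-cong : ∀ k {p q} → p ≈ q → signP k p ≈ signP k q
signP-cong zero    e = e
signP-cong (suc k) e = negP-cong (signP-cong k e)

signP-[] : ∀ k → signP k [] ≡ []
signP-[] zero    = refl
signP-[] (suc k) = cong negP (signP-[] k)

signP-zero : ∀ k {p} → p ≈ [] → signP k p ≈ []
signP-zero k e = ≈-trans (signP-cong k e) (≈-reflexive (signP-[] k))

signP-distribʳ-*P : ∀ k p q → signP k p *P q ≈ signP k (p *P q)
signP-distribʳ-*P zero    p q = ≈-refl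
signP-distribʳ-*P (suc k) p q =
  ≈-trans (negP-distribʳ (signP k p) q) (negP-cong (signP-distribʳ-*P k p q))
  where
  negP-distribʳ : ∀ a b → negP a *P b ≈ negP (a *P b)
  negP-distribʳ = solve-∀ ℤ[x]-almost

signP-distribˡ-*P : ∀ k p q → p *P signP k q ≈ signP k (p *P q)
signP-distribˡ-*P k p q = ≈-trans (*P-comm p (signP k q))
  (≈-trans (signP-distribʳ-*P k q p) (signP-cong k (*P-comm q p)))

signP-distrib-+P : ∀ k p q → signP k (p +P q) ≈ signP k p +P signP k q
signP-distrib-+P zero    p q = ≈-refl
signP-distrib-+P (suc k) p q =
  ≈-trans (negP-cong (signP-distrib-+P k p q)) (negP-distrib (signP k p) (signP k q))
  where
  negP-distrib : ∀ a b → negP (a +P b) ≈ negP a +P negP b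
  negP-distrib = solve-∀ ℤ[x]-almost

signP-sumP : ∀ k n (f : Fin n → Poly) → signP k (sumP n f) ≈ sumP n (signP k ∘ f)
signP-sumP k zero    f = ≈-reflexive (signP-[] k)
signP-sumP k (suc n) f = ≈-trans (signP-distrib-+P k (f zero) (sumP n (f ∘ suc)))
  (+P-congˡ (signP k (f zero)) (signP-sumP k n (f ∘ suc)))

signP-+ : ∀ m n p → signP (m + n) p ≡ signP m (signP n p)
signP-+ zero    n p = refl
signP-+ (suc m) n p = cong negP (signP-+ m n p)

signP-even : ∀ t m p → signP (t + t + m) p ≈ signP m p
signP-even zero    m p = ≈-refl
signP-even (suc t) m p rewrite ℕP.+-suc t t =
  ≈-trans (negP-involutive (signP (t + t + m) p)) (signP-even t m p)
  where
  negP-involutive : ∀ a → negP (negP a) ≈ a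
  negP-involutive = solve-∀ ℤ[x]-almost

signP-≡ : ∀ {m n} p → m ≡ n → signP m p ≈ signP n p
signP-≡ p refl = ≈-refl

det-cong : ∀ n {M N : Mat n} → (∀ i j → M i j ≈ N i j) → det n M ≈ det n N
det-cong zero    e = ≈-refl
det-cong (suc n) e = sumP-cong (suc n) λ j → signP-cong (toℕ j)
  (*P-cong (e zero j) (det-cong n (λ r c → e (suc r) (punchIn j c))))

laplaceTerm : ∀ n (M : Mat (suc n)) → Fin (suc n) → Poly
laplaceTerm n M j = signP (toℕ j) (M zero j *P det n (minor M zero j))

laplaceTerm-zero : ∀ n (M : Mat (suc n)) j → M zero j ≈ [] → laplaceTerm n M j ≈ []
laplaceTerm-zero n M j z = signP-zero (toℕ j) (*P-congʳ (det n (minor M zero j)) z)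

laplaceTerm-zeroMinor : ∀ n (M : Mat (suc n)) j → det n (minor M zero j) ≈ [] → laplaceTerm n M j ≈ []
laplaceTerm-zeroMinor n M j z = signP-zero (toℕ j) (≈-trans (*P-congˡ (M zero j) z) (*P-comm (M zero j) []))

det-zeroRow : ∀ n (M : Mat (suc n)) k → (∀ c → M k c ≈ []) → det (suc n) M ≈ []
det-zeroRow n       M zero    z = sumP-zero (suc n) λ j → laplaceTerm-zero n M j (z j)
det-zeroRow (suc n) M (suc k) z = sumP-zero (suc (suc n)) λ j →
  laplaceTerm-zeroMinor (suc n) M j (det-zeroRow n (minor M zero j) k (λ c → z (punchIn j c)))

det-zeroCol₀ : ∀ n (M : Mat (suc n)) → (∀ r → M r zero ≈ []) → det (suc n) M ≈ []
det-zeroCol₀ n M z = sumP-zero (suc n) (vanish n M z)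
  where
  vanish : ∀ n (M : Mat (suc n)) → (∀ r → M r zero ≈ []) → ∀ j → laplaceTerm n M j ≈ []
  vanish n       M z zero    = laplaceTerm-zero n M zero (z zero)
  vanish (suc n) M z (suc j) =
    laplaceTerm-zeroMinor (suc n) M (suc j) (det-zeroCol₀ n (minor M zero (suc j)) (z ∘ suc))

det-linear-row : ∀ n (A B C : Mat (suc n)) k →
  (∀ i c → i ≢ k → A i c ≈ B i c) → (∀ i c → i ≢ k → A i c ≈ C i c) →
  (∀ c → A k c ≈ B k c +P C k c) → det (suc n) A ≈ det (suc n) B +P det (suc n) C
det-linear-row n A B C zero rowsB rowsC rowK =
  ≈-trans (sumP-cong (suc n) λ j → ≈-trans (signP-cong (toℕ j)
     (≈-trans (*P-congʳ (det n (minor A zero j)) (rowK j))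
       (≈-trans (*P-distribʳ-+P (det n (minor A zero j)) (B zero j) (C zero j))
         (+P-cong (*P-congˡ (B zero j) (det-cong n λ r c → rowsB (suc r) (punchIn j c) λ ()))
                  (*P-congˡ (C zero j) (det-cong n λ r c → rowsC (suc r) (punchIn j c) λ ()))))))
     (signP-distrib-+P (toℕ j) (B zero j *P det n (minor B zero j)) (C zero j *P det n (minor C zero j))))
  (sumP-+P (suc n) (laplaceTerm n B) (laplaceTerm n C))
det-linear-row (suc n) A B C (suc k) rowsB rowsC rowK =
  ≈-trans (sumP-cong (suc (suc n)) λ j → ≈-trans (signP-cong (toℕ j)
     (≈-trans (*P-congˡ (A zero j) (det-linear-row n (minor A zero j) (minor B zero j) (minor C zero j) k
          (λ i c ne → rowsB (suc i) (punchIn j c) (ne ∘ FinP.suc-injective))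
          (λ i c ne → rowsC (suc i) (punchIn j c) (ne ∘ FinP.suc-injective))
          (λ c → rowK (punchIn j c))))
     (≈-trans (*P-distribˡ-+P (A zero j) (det (suc n) (minor B zero j)) (det (suc n) (minor C zero j)))
       (+P-cong (*P-congʳ (det (suc n) (minor B zero j)) (rowsB zero j λ ()))
                (*P-congʳ (det (suc n) (minor C zero j)) (rowsC zero j λ ()))))))
     (signP-distrib-+P (toℕ j) (B zero j *P det (suc n) (minor B zero j)) (C zero j *P det (suc n) (minor C zero j))))
  (sumP-+P (suc (suc n)) (laplaceTerm (suc n) B) (laplaceTerm (suc n) C))

punchIn-↑ˡ-↑ʳ : ∀ {a} b (x : Fin (suc a)) (j : Fin b) → punchIn (x ↑ˡ b) (a ↑ʳ j) ≡ suc a ↑ʳ j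
punchIn-↑ˡ-↑ʳ         b zero    j = refl
punchIn-↑ˡ-↑ʳ {suc a} b (suc x) j = cong suc (punchIn-↑ˡ-↑ʳ b x j)

punchIn-↑ˡ-↑ˡ : ∀ {a} b (x : Fin (suc a)) (j : Fin a) → punchIn (x ↑ˡ b) (j ↑ˡ b) ≡ punchIn x j ↑ˡ b
punchIn-↑ˡ-↑ˡ b zero    j       = refl
punchIn-↑ˡ-↑ˡ b (suc x) zero    = refl
punchIn-↑ˡ-↑ˡ b (suc x) (suc j) = cong suc (punchIn-↑ˡ-↑ˡ b x j)

det-blockTriangular : ∀ a b (M : Mat (a + b)) → (∀ i j → M (i ↑ˡ b) (a ↑ʳ j) ≈ []) →
  det (a + b) M ≈ det a (λ i j → M (i ↑ˡ b) (j ↑ˡ b)) *P det b (λ i j → M (a ↑ʳ i) (a ↑ʳ j))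
det-blockTriangular zero    b M z = ≈-sym (*P-identityˡ (det b M))
det-blockTriangular (suc a) b M z =
  ≈-trans (sumP-↑ (suc a) b (laplaceTerm (a + b) M))
  (≈-trans (+P-cong (sumP-cong (suc a) leftTerm)
                    (sumP-zero b λ y → laplaceTerm-zero (a + b) M (suc a ↑ʳ y) (z zero y)))
  (≈-trans (+P-identityʳ _) (≈-sym (sumP-*Pʳ (suc a) D (laplaceTerm a A)))))
  where
  A : Mat (suc a)
  A i j = M (i ↑ˡ b) (j ↑ˡ b)
  D : Poly
  D = det b (λ i j → M (suc a ↑ʳ i) (suc a ↑ʳ j))
  minorBlocks : ∀ x → det (a + b) (minor M zero (x ↑ˡ b)) ≈ det a (minor A zero x) *P D
  minorBlocks x =
    ≈-trans (det-blockTriangular a b (minor M zero (x ↑ˡ b))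
              (λ i j → ≈-trans (≈-reflexive (cong (M (suc (i ↑ˡ b))) (punchIn-↑ˡ-↑ʳ b x j))) (z (suc i) j)))
      (*P-cong (det-cong a λ i j → ≈-reflexive (cong (M (suc i ↑ˡ b)) (punchIn-↑ˡ-↑ˡ b x j)))
               (det-cong b λ i j → ≈-reflexive (cong (M (suc a ↑ʳ i)) (punchIn-↑ˡ-↑ʳ b x j))))
  leftTerm : ∀ x → laplaceTerm (a + b) M (x ↑ˡ b) ≈ laplaceTerm a A x *P D
  leftTerm x =
    ≈-trans (signP-≡ _ (FinP.toℕ-↑ˡ x b))
    (≈-trans (signP-cong (toℕ x) (≈-trans (*P-congˡ (A zero x) (minorBlocks x))
                                           (≈-sym (*P-assoc (A zero x) (det a (minor A zero x)) D))))
             (≈-sym (signP-distribʳ-*P (toℕ x) _ D)))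

toℕ-punchIn-< : ∀ {n} (i : Fin (suc n)) (j : Fin n) → toℕ j < toℕ i → toℕ (punchIn i j) ≡ toℕ j
toℕ-punchIn-< zero    j       ()
toℕ-punchIn-< (suc i) zero    lt       = refl
toℕ-punchIn-< (suc i) (suc j) (s≤s lt) = cong suc (toℕ-punchIn-< i j lt)

toℕ-punchIn-≥ : ∀ {n} (i : Fin (suc n)) (j : Fin n) → toℕ i ≤ toℕ j → toℕ (punchIn i j) ≡ suc (toℕ j)
toℕ-punchIn-≥ zero    j       le       = refl
toℕ-punchIn-≥ (suc i) (suc j) (s≤s le) = cong suc (toℕ-punchIn-≥ i j le)

toℕ-punchIn-≤ : ∀ {n} (i : Fin (suc n)) (j : Fin n) → toℕ (punchIn i j) ≤ suc (toℕ j)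
toℕ-punchIn-≤ zero    j       = ℕP.≤-refl
toℕ-punchIn-≤ (suc i) zero    = z≤n
toℕ-punchIn-≤ (suc i) (suc j) = s≤s (toℕ-punchIn-≤ i j)

toℕ-≤-punchIn : ∀ {n} (i : Fin (suc n)) (j : Fin n) → toℕ j ≤ toℕ (punchIn i j)
toℕ-≤-punchIn i j with toℕ j <? toℕ i
... | yes lt = ℕP.≤-reflexive (sym (toℕ-punchIn-< i j lt))
... | no ge  = subst (toℕ j ≤_) (sym (toℕ-punchIn-≥ i j (ℕP.≮⇒≥ ge))) (ℕP.n≤1+n _)

-- The first p′ columns vanish outside the first p < p′ rows, so they are linearly dependent.
det-zeroBlocks : ∀ n (M : Mat n) p p′ → p < p′ → p′ ≤ n →
  (∀ i j → toℕ i < p → p′ ≤ toℕ j → M i j ≈ []) →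
  (∀ i j → p ≤ toℕ i → toℕ j < p′ → M i j ≈ []) → det n M ≈ []
det-zeroBlocks zero    M p       .zero    lt      z≤n      top bot = ⊥-elim (ℕP.n≮0 lt)
det-zeroBlocks (suc n) M zero    p′       lt      le       top bot = det-zeroCol₀ n M (λ r → bot r zero z≤n lt)
det-zeroBlocks (suc n) M (suc p) (suc p′) (s≤s lt) (s≤s le) top bot = sumP-zero (suc n) vanish
  where
  vanish : ∀ j → laplaceTerm n M j ≈ []
  vanish j with toℕ j <? suc p′
  ... | yes j<p′ = laplaceTerm-zeroMinor n M j (det-zeroBlocks n (minor M zero j) p p′ lt le
          (λ i c i<p p′≤c → top (suc i) (punchIn j c) (s≤s i<p)
             (subst (suc p′ ≤_) (sym (toℕ-punchIn-≥ j c (ℕP.≤-trans (ℕP.≤-pred j<p′) p′≤c))) (s≤s p′≤c)))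
          (λ i c p≤i c<p′ → bot (suc i) (punchIn j c) (s≤s p≤i) (ℕP.≤-<-trans (toℕ-punchIn-≤ j c) (s≤s c<p′))))
  ... | no j≮p′ = laplaceTerm-zero n M j (top zero j (s≤s z≤n) (ℕP.≮⇒≥ j≮p′))

punchIn-punchIn-punchOut : ∀ {n} (j : Fin (suc (suc n))) (c : Fin (suc n)) (j≢ : punchIn j c ≢ j) (d : Fin n) →
  punchIn (punchIn j c) (punchIn (punchOut j≢) d) ≡ punchIn j (punchIn c d)
punchIn-punchIn-punchOut zero    c       j≢ d = refl
punchIn-punchIn-punchOut (suc j) zero    j≢ d = refl
punchIn-punchIn-punchOut {suc n} (suc j) (suc c) j≢ zero    = refl
punchIn-punchIn-punchOut {suc n} (suc j) (suc c) j≢ (suc d) =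
  cong suc (punchIn-punchIn-punchOut j c (j≢ ∘ cong suc) d)

signP-punchIn-punchOut : ∀ {n} (j : Fin (suc (suc n))) (c : Fin (suc n)) (j≢ : punchIn j c ≢ j) k p →
  signP (toℕ (punchIn j c) + (k + toℕ (punchOut j≢))) p ≈ signP (suc k + toℕ j + toℕ c) p
signP-punchIn-punchOut j c j≢ k p with toℕ c <? toℕ j
... | yes c<j =
  ≈-trans (signP-≡ p (cong (_+ (k + j′)) (toℕ-punchIn-< j c c<j)))
  (≈-trans (≈-sym (signP-even 1 (toℕ c + (k + j′)) p)) (signP-≡ p exponent))
  where
  j′ = toℕ (punchOut j≢)
  back : toℕ (punchIn (punchIn j c) (punchOut j≢)) ≡ toℕ j
  back = cong toℕ (FinP.punchIn-punchOut j≢)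
  j≡1+j′ : toℕ j ≡ suc j′
  j≡1+j′ with j′ <? toℕ (punchIn j c)
  ... | yes lt = ⊥-elim (ℕP.<-irrefl refl (ℕP.<-trans c<j
         (subst (_< toℕ c) (trans (sym (toℕ-punchIn-< (punchIn j c) (punchOut j≢) lt)) back)
            (subst (j′ <_) (toℕ-punchIn-< j c c<j) lt))))
  ... | no ge = trans (sym back) (toℕ-punchIn-≥ (punchIn j c) (punchOut j≢) (ℕP.≮⇒≥ ge))
  shuffle : ∀ a b c → 1 + 1 + (c + (a + b)) ≡ suc a + suc b + c
  shuffle = solve-ℕ
  exponent : 1 + 1 + (toℕ c + (k + j′)) ≡ suc k + toℕ j + toℕ c
  exponent = trans (shuffle k j′ (toℕ c)) (cong (λ z → suc k + z + toℕ c) (sym j≡1+j′))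
... | no c≮j = signP-≡ p (trans (cong₂ (λ a b → a + (k + b)) pc≡1+c j′≡j) (shuffle k (toℕ j) (toℕ c)))
  where
  j′ = toℕ (punchOut j≢)
  back : toℕ (punchIn (punchIn j c) (punchOut j≢)) ≡ toℕ j
  back = cong toℕ (FinP.punchIn-punchOut j≢)
  pc≡1+c : toℕ (punchIn j c) ≡ suc (toℕ c)
  pc≡1+c = toℕ-punchIn-≥ j c (ℕP.≮⇒≥ c≮j)
  j′≡j : j′ ≡ toℕ j
  j′≡j with j′ <? toℕ (punchIn j c)
  ... | yes lt = trans (sym (toℕ-punchIn-< (punchIn j c) (punchOut j≢) lt)) back
  ... | no ge = ⊥-elim (c≮j (ℕP.≤-trans (s≤s (ℕP.≤-trans (ℕP.n≤1+n _) (subst (_≤ j′) pc≡1+c (ℕP.≮⇒≥ ge))))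
                 (ℕP.≤-reflexive (trans (sym (toℕ-punchIn-≥ (punchIn j c) (punchOut j≢) (ℕP.≮⇒≥ ge))) back))))
  shuffle : ∀ a b c → suc c + (a + b) ≡ suc a + b + c
  shuffle = solve-ℕ

det-singleEntryRow : ∀ n (M : Mat (suc n)) k j → (∀ c → c ≢ j → M k c ≈ []) →
  det (suc n) M ≈ signP (toℕ k + toℕ j) (M k j *P det n (minor M k j))
det-singleEntryRow n       M zero    j z =
  sumP-single n (laplaceTerm n M) j (λ c c≢j → laplaceTerm-zero n M c (z c c≢j))
det-singleEntryRow (suc n) M (suc k) j z =
  ≈-trans (sumP-punchIn (suc n) (laplaceTerm (suc n) M) j)
  (≈-trans (+P-congʳ (sumP (suc n) (laplaceTerm (suc n) M ∘ punchIn j))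
             (laplaceTerm-zeroMinor (suc n) M j
               (det-zeroRow n (minor M zero j) k (λ c → z (punchIn j c) (FinP.punchInᵢ≢i j c)))))
  (≈-trans (sumP-cong (suc n) expandMinor)
  (≈-trans (≈-sym (signP-sumP e (suc n) (λ c → m *P laplaceTerm n Q c)))
           (signP-cong e (≈-sym (sumP-*Pˡ (suc n) m (laplaceTerm n Q)))))))
  where
  e = toℕ (suc k) + toℕ j
  m = M (suc k) j
  Q = minor M (suc k) j
  -- Each surviving first-row term is expanded along the row of the entry m.
  expandMinor : ∀ c → laplaceTerm (suc n) M (punchIn j c) ≈ signP e (m *P laplaceTerm n Q c)
  expandMinor c =
    ≈-trans (signP-cong s (*P-congˡ a inner))
    (≈-trans (signP-cong s (signP-distribˡ-*P (toℕ k + toℕ j′) a (m *P d)))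
    (≈-trans (≈-reflexive (sym (signP-+ s (toℕ k + toℕ j′) (a *P (m *P d)))))
    (≈-trans (signP-cong (s + (toℕ k + toℕ j′)) (left-comm a m d))
    (≈-trans (signP-punchIn-punchOut j c j≢ (toℕ k) (m *P (a *P d)))
    (≈-trans (≈-reflexive (signP-+ (suc (toℕ k + toℕ j)) (toℕ c) (m *P (a *P d))))
             (signP-cong e (≈-sym (signP-distribˡ-*P (toℕ c) m (a *P d)))))))))
    where
    left-comm : ∀ a b c → a *P (b *P c) ≈ b *P (a *P c)
    left-comm = solve-∀ ℤ[x]-almost
    j≢ : punchIn j c ≢ j
    j≢ = FinP.punchInᵢ≢i j c
    j′ = punchOut j≢
    s = toℕ (punchIn j c)
    a = M zero (punchIn j c)
    N = minor M zero (punchIn j c)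
    d = det n (minor Q zero c)
    inner : det (suc n) N ≈ signP (toℕ k + toℕ j′) (m *P d)
    inner = ≈-trans
      (det-singleEntryRow n N k j′ (λ c′ c′≢j′ → z (punchIn (punchIn j c) c′)
         (λ eq → c′≢j′ (FinP.punchIn-injective (punchIn j c) c′ j′ (trans eq (sym (FinP.punchIn-punchOut j≢)))))))
      (signP-cong (toℕ k + toℕ j′)
        (*P-cong (≈-reflexive (cong (M (suc k)) (FinP.punchIn-punchOut j≢)))
                 (det-cong n λ r c″ → ≈-reflexive (cong (M (suc (punchIn k r))) (punchIn-punchIn-punchOut j c j≢ c″)))))

det-cast : ∀ {m n} (e : m ≡ n) (M : Mat n) → det m (λ i j → M (cast e i) (cast e j)) ≈ det n M
det-cast {m} refl M = det-cong m λ i j → ≈-reflexive (cong₂ M (FinP.cast-is-id refl i) (FinP.cast-is-id refl j))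

data BlockView (a b : ℕ) : Fin (a + b) → Set where
  left  : (x : Fin a) → BlockView a b (x ↑ˡ b)
  right : (y : Fin b) → BlockView a b (a ↑ʳ y)

blockView : ∀ a b (i : Fin (a + b)) → BlockView a b i
blockView a b i with splitAt a i in eq
... | inj₁ x = subst (BlockView a b) (FinP.splitAt⁻¹-↑ˡ eq) (left x)
... | inj₂ y = subst (BlockView a b) (FinP.splitAt⁻¹-↑ʳ eq) (right y)

toℕ-↑ˡ<toℕ-↑ʳ : ∀ {a b} (x : Fin a) (y : Fin b) → toℕ (x ↑ˡ b) < toℕ (a ↑ʳ y)
toℕ-↑ˡ<toℕ-↑ʳ {a} {b} x y = subst₂ _<_ (sym (FinP.toℕ-↑ˡ x b)) (sym (FinP.toℕ-↑ʳ a y))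
  (ℕP.<-≤-trans (FinP.toℕ<n x) (ℕP.m≤m+n a (toℕ y)))

↑ˡ≢↑ʳ : ∀ {a b} (x : Fin a) (y : Fin b) → x ↑ˡ b ≢ a ↑ʳ y
↑ˡ≢↑ʳ x y eq = ℕP.<-irrefl (cong toℕ eq) (toℕ-↑ˡ<toℕ-↑ʳ x y)

rowPart : ∀ {n ℓ} {P : Pred (Fin n) ℓ} → Decidable P → Fin n → Mat n → Mat n
rowPart P? k M i j = if does (i ≟ k) ∧ not (does (P? j)) then [] else M i j

module _ {n ℓ} {P : Pred (Fin n) ℓ} (P? : Decidable P) (k : Fin n) (M : Mat n) where

  rowPart-≢ : ∀ {i} j → i ≢ k → rowPart P? k M i j ≡ M i j
  rowPart-≢ {i} j i≢k with i ≟ k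
  ... | yes i≡k = ⊥-elim (i≢k i≡k)
  ... | no _    = refl

  rowPart-∈ : ∀ i {j} → P j → rowPart P? k M i j ≡ M i j
  rowPart-∈ i {j} pj with i ≟ k | P? j
  ... | yes _ | yes _  = refl
  ... | yes _ | no ¬pj = ⊥-elim (¬pj pj)
  ... | no _  | _      = refl

  rowPart-∉ : ∀ {i j} → i ≡ k → ¬ P j → rowPart P? k M i j ≡ []
  rowPart-∉ {i} {j} i≡k ¬pj with i ≟ k | P? j
  ... | no i≢k | _      = ⊥-elim (i≢k i≡k)
  ... | yes _  | yes pj = ⊥-elim (¬pj pj)
  ... | yes _  | no _   = refl

det-rowPart : ∀ n {ℓ} {P : Pred (Fin (suc n)) ℓ} (P? : Decidable P) k (M : Mat (suc n)) →
  det (suc n) M ≈ det (suc n) (rowPart P? k M) +P det (suc n) (rowPart (∁? P?) k M)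
det-rowPart n {P = P} P? k M = det-linear-row n M (rowPart P? k M) (rowPart (∁? P?) k M) k
  (λ i c i≢k → ≈-reflexive (sym (rowPart-≢ P? k M c i≢k)))
  (λ i c i≢k → ≈-reflexive (sym (rowPart-≢ (∁? P?) k M c i≢k)))
  split
  where
  split : ∀ c → M k c ≈ rowPart P? k M k c +P rowPart (∁? P?) k M k c
  split c = byCase (P? c)
    where
    byCase : Dec (P c) → M k c ≈ rowPart P? k M k c +P rowPart (∁? P?) k M k c
    byCase (yes pc) = ≈-sym (≈-trans (+P-cong (≈-reflexive (rowPart-∈ P? k M k pc))
                                         (≈-reflexive (rowPart-∉ (∁? P?) k M refl (λ ¬pc → ¬pc pc))))
                                (+P-identityʳ (M k c)))
    byCase (no ¬pc) = ≈-sym (+P-cong (≈-reflexive (rowPart-∉ P? k M refl ¬pc))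
                                (≈-reflexive (rowPart-∈ (∁? P?) k M k ¬pc)))

-- Split row k₀ into its left and right parts. The left part leaves a block-triangular matrix; the
-- right part has the single entry u, and in its minor the old row j₀ has, up to a zero-block
-- remainder, the single entry v.
module BridgedBlocks {p q : ℕ} (X : Mat (suc p + suc q)) (r : Fin (suc p)) (f : Fin (suc q))
  (upperZero : ∀ x y → ¬ (x ≡ r × y ≡ f) → X (x ↑ˡ suc q) (suc p ↑ʳ y) ≈ [])
  (lowerZero : ∀ x y → ¬ (x ≡ r × y ≡ f) → X (suc p ↑ʳ y) (x ↑ˡ suc q) ≈ []) where

  a b : ℕ
  a = suc p
  b = suc q

  A : Mat a
  A i j = X (i ↑ˡ b) (j ↑ˡ b)

  D : Mat b
  D i j = X (a ↑ʳ i) (a ↑ʳ j)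

  k₀ j₀ : Fin (a + b)
  k₀ = r ↑ˡ b
  j₀ = a ↑ʳ f

  u v : Poly
  u = X k₀ j₀
  v = X j₀ k₀

  toℕ-k₀ : toℕ k₀ ≡ toℕ r
  toℕ-k₀ = FinP.toℕ-↑ˡ r b

  toℕ-j₀ : toℕ j₀ ≡ a + toℕ f
  toℕ-j₀ = FinP.toℕ-↑ʳ a f

  r≤p : toℕ r ≤ p
  r≤p = ℕP.≤-pred (FinP.toℕ<n r)

  ↑ˡ-< : ∀ (x : Fin a) → toℕ (x ↑ˡ b) < a
  ↑ˡ-< x = subst (_< a) (sym (FinP.toℕ-↑ˡ x b)) (FinP.toℕ<n x)

  ↑ʳ-≥ : ∀ (y : Fin b) → a ≤ toℕ (a ↑ʳ y)
  ↑ʳ-≥ y = subst (a ≤_) (sym (FinP.toℕ-↑ʳ a y)) (ℕP.m≤m+n a (toℕ y))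

  upperZeroℕ : ∀ i j → toℕ i < a → a ≤ toℕ j → (toℕ i ≡ toℕ r → toℕ j ≡ a + toℕ f → ⊥) → X i j ≈ []
  upperZeroℕ i j i<a a≤j notBridge = go (blockView a b i) (blockView a b j) i<a a≤j notBridge
    where
    go : ∀ {i j} → BlockView a b i → BlockView a b j → toℕ i < a → a ≤ toℕ j →
         (toℕ i ≡ toℕ r → toℕ j ≡ a + toℕ f → ⊥) → X i j ≈ []
    go (left x)  (left y)  _   a≤j _ = ⊥-elim (ℕP.<⇒≱ (↑ˡ-< y) a≤j)
    go (left x)  (right y) _   _   notBridge = upperZero x y λ (x≡r , y≡f) →
      notBridge (trans (FinP.toℕ-↑ˡ x b) (cong toℕ x≡r)) (trans (FinP.toℕ-↑ʳ a y) (cong (λ z → a + toℕ z) y≡f))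
    go (right x) _         i<a _   _ = ⊥-elim (ℕP.<⇒≱ i<a (↑ʳ-≥ x))

  lowerZeroℕ : ∀ i j → a ≤ toℕ i → toℕ j < a → (toℕ i ≡ a + toℕ f → toℕ j ≡ toℕ r → ⊥) → X i j ≈ []
  lowerZeroℕ i j a≤i j<a notBridge = go (blockView a b i) (blockView a b j) a≤i j<a notBridge
    where
    go : ∀ {i j} → BlockView a b i → BlockView a b j → a ≤ toℕ i → toℕ j < a →
         (toℕ i ≡ a + toℕ f → toℕ j ≡ toℕ r → ⊥) → X i j ≈ []
    go (left x)  _         a≤i _   _ = ⊥-elim (ℕP.<⇒≱ (↑ˡ-< x) a≤i)
    go (right y) (left x)  _   _   notBridge = lowerZero x y λ (x≡r , y≡f) →
      notBridge (trans (FinP.toℕ-↑ʳ a y) (cong (λ z → a + toℕ z) y≡f)) (trans (FinP.toℕ-↑ˡ x b) (cong toℕ x≡r))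
    go (right y) (right x) _   j<a _ = ⊥-elim (ℕP.<⇒≱ j<a (↑ʳ-≥ x))

  inLeft? : Decidable (λ (j : Fin (a + b)) → toℕ j < a)
  inLeft? j = toℕ j <? a

  keepLeft keepRight : Mat (a + b)
  keepLeft  = rowPart inLeft? k₀ X
  keepRight = rowPart (∁? inLeft?) k₀ X

  det-keepLeft : det (a + b) keepLeft ≈ det a A *P det b D
  det-keepLeft = ≈-trans (det-blockTriangular a b keepLeft upper)
    (*P-cong (det-cong a λ i j → ≈-reflexive (rowPart-∈ inLeft? k₀ X (i ↑ˡ b) (↑ˡ-< j)))
             (det-cong b λ i j → ≈-reflexive (rowPart-≢ inLeft? k₀ X (a ↑ʳ j) (↑ˡ≢↑ʳ r i ∘ sym))))
    where
    upper : ∀ i j → keepLeft (i ↑ˡ b) (a ↑ʳ j) ≈ []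
    upper i j with (i ↑ˡ b) ≟ k₀
    ... | yes i≡r  = ≈-reflexive (rowPart-∉ inLeft? k₀ X i≡r (λ lt → ℕP.<⇒≱ lt (↑ʳ-≥ j)))
    ... | no i≢r   = ≈-trans (≈-reflexive (rowPart-≢ inLeft? k₀ X (a ↑ʳ j) i≢r))
        (upperZeroℕ (i ↑ˡ b) (a ↑ʳ j) (↑ˡ-< i) (↑ʳ-≥ j) (λ eq _ → i≢r (FinP.toℕ-injective (trans eq (sym toℕ-k₀)))))

  keepRight-row : ∀ c → c ≢ j₀ → keepRight k₀ c ≈ []
  keepRight-row c c≢j₀ with toℕ c <? a
  ... | yes c<a = ≈-reflexive (rowPart-∉ (∁? inLeft?) k₀ X refl (λ c≮a → c≮a c<a))
  ... | no c≮a  = ≈-trans (≈-reflexive (rowPart-∈ (∁? inLeft?) k₀ X k₀ c≮a))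
      (upperZeroℕ k₀ c (subst (_< a) (sym toℕ-k₀) (FinP.toℕ<n r)) (ℕP.≮⇒≥ c≮a)
                  (λ _ eq → c≢j₀ (FinP.toℕ-injective (trans eq (sym toℕ-j₀)))))

  keepRight-u : keepRight k₀ j₀ ≡ u
  keepRight-u = rowPart-∈ (∁? inLeft?) k₀ X k₀ (λ lt → ℕP.<⇒≱ lt (↑ʳ-≥ f))

  -- The minor of keepRight at (k₀, j₀), recast to size suc (p + q) so that it can be expanded again.
  n₀ : ℕ
  n₀ = p + q

  size : suc n₀ ≡ p + b
  size = sym (ℕP.+-suc p q)

  ρ κ : Fin (suc n₀) → Fin (a + b)
  ρ i = punchIn k₀ (cast size i)
  κ j = punchIn j₀ (cast size j)

  Y : Mat (suc n₀)
  Y i j = minor keepRight k₀ j₀ (cast size i) (cast size j)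

  Y≡X : ∀ i j → Y i j ≡ X (ρ i) (κ j)
  Y≡X i j = rowPart-≢ (∁? inLeft?) k₀ X (κ j) (FinP.punchInᵢ≢i k₀ (cast size i))

  det-keepRight-expand : det (a + b) keepRight ≈ signP (toℕ k₀ + toℕ j₀) (u *P det (suc n₀) Y)
  det-keepRight-expand =
    ≈-trans (det-singleEntryRow (p + b) keepRight k₀ j₀ keepRight-row)
      (signP-cong (toℕ k₀ + toℕ j₀) (*P-cong (≈-reflexive keepRight-u) (≈-sym (det-cast size (minor keepRight k₀ j₀)))))

  toℕ-cast : ∀ i → toℕ (cast size i) ≡ toℕ i
  toℕ-cast i = FinP.toℕ-cast size i

  toℕ-ρ-< : ∀ i → toℕ i < toℕ r → toℕ (ρ i) ≡ toℕ i
  toℕ-ρ-< i lt = trans (toℕ-punchIn-< k₀ (cast size i) (subst₂ _<_ (sym (toℕ-cast i)) (sym toℕ-k₀) lt)) (toℕ-cast i)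

  toℕ-ρ-≥ : ∀ i → toℕ r ≤ toℕ i → toℕ (ρ i) ≡ suc (toℕ i)
  toℕ-ρ-≥ i le = trans (toℕ-punchIn-≥ k₀ (cast size i) (subst₂ _≤_ (sym toℕ-k₀) (sym (toℕ-cast i)) le)) (cong suc (toℕ-cast i))

  toℕ-κ-< : ∀ j → toℕ j < a + toℕ f → toℕ (κ j) ≡ toℕ j
  toℕ-κ-< j lt = trans (toℕ-punchIn-< j₀ (cast size j) (subst₂ _<_ (sym (toℕ-cast j)) (sym toℕ-j₀) lt)) (toℕ-cast j)

  toℕ-κ-≥ : ∀ j → a + toℕ f ≤ toℕ j → toℕ (κ j) ≡ suc (toℕ j)
  toℕ-κ-≥ j le = trans (toℕ-punchIn-≥ j₀ (cast size j) (subst₂ _≤_ (sym toℕ-j₀) (sym (toℕ-cast j)) le)) (cong suc (toℕ-cast j))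

  toℕ-ρ-≤ : ∀ i → toℕ (ρ i) ≤ suc (toℕ i)
  toℕ-ρ-≤ i = subst (λ z → toℕ (ρ i) ≤ suc z) (toℕ-cast i) (toℕ-punchIn-≤ k₀ (cast size i))

  toℕ-κ-≥′ : ∀ j → toℕ j ≤ toℕ (κ j)
  toℕ-κ-≥′ j = subst (_≤ toℕ (κ j)) (toℕ-cast j) (toℕ-≤-punchIn j₀ (cast size j))

  ρ≢r : ∀ i → toℕ (ρ i) ≢ toℕ r
  ρ≢r i eq = FinP.punchInᵢ≢i k₀ (cast size i) (FinP.toℕ-injective (trans eq (sym toℕ-k₀)))

  -- In Y the old row j₀ becomes row i₁ and the old column k₀ becomes column c₁.
  i₁ c₁ : Fin (suc n₀)
  i₁ = cast (sym size) (p ↑ʳ f)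
  c₁ = r ↑ˡ q

  toℕ-i₁ : toℕ i₁ ≡ p + toℕ f
  toℕ-i₁ = trans (FinP.toℕ-cast (sym size) (p ↑ʳ f)) (FinP.toℕ-↑ʳ p f)

  toℕ-c₁ : toℕ c₁ ≡ toℕ r
  toℕ-c₁ = FinP.toℕ-↑ˡ r q

  Y-v : Y i₁ c₁ ≈ v
  Y-v = ≈-reflexive (trans (Y≡X i₁ c₁) (cong₂ X (FinP.toℕ-injective ρi₁) (FinP.toℕ-injective κc₁)))
    where
    ρi₁ : toℕ (ρ i₁) ≡ toℕ j₀
    ρi₁ = trans (toℕ-ρ-≥ i₁ (subst (toℕ r ≤_) (sym toℕ-i₁) (ℕP.≤-trans r≤p (ℕP.m≤m+n p (toℕ f)))))
                (trans (cong suc toℕ-i₁) (sym toℕ-j₀))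
    κc₁ : toℕ (κ c₁) ≡ toℕ k₀
    κc₁ = trans (toℕ-κ-< c₁ (subst (_< a + toℕ f) (sym toℕ-c₁) (ℕP.<-≤-trans (FinP.toℕ<n r) (ℕP.m≤m+n a (toℕ f)))))
                (trans toℕ-c₁ (sym toℕ-k₀))

  atC₁? : Decidable (_≡ c₁)
  atC₁? j = j ≟ c₁

  Yc Yrest : Mat (suc n₀)
  Yc    = rowPart atC₁? i₁ Y
  Yrest = rowPart (∁? atC₁?) i₁ Y

  i≢i₁ : ∀ i → toℕ i < p → i ≢ i₁
  i≢i₁ i i<p eq = ℕP.<⇒≱ i<p (subst (p ≤_) (trans (sym toℕ-i₁) (cong toℕ (sym eq))) (ℕP.m≤m+n p (toℕ f)))

  ρ-≥ : ∀ i → p ≤ toℕ i → a ≤ toℕ (ρ i)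
  ρ-≥ i le = subst (a ≤_) (sym (toℕ-ρ-≥ i (ℕP.≤-trans r≤p le))) (s≤s le)

  κ-< : ∀ j → toℕ j < a → toℕ (κ j) < a
  κ-< j lt = subst (_< a) (sym (toℕ-κ-< j (ℕP.<-≤-trans lt (ℕP.m≤m+n a (toℕ f))))) lt

  -- Without its entry in column c₁, row i₁ also vanishes on the first a columns,
  -- so these are supported on the first p rows.
  det-Yrest : det (suc n₀) Yrest ≈ []
  det-Yrest = det-zeroBlocks (suc n₀) Yrest p a ℕP.≤-refl (s≤s (ℕP.m≤m+n p q)) top bottom
    where
    top : ∀ i j → toℕ i < p → a ≤ toℕ j → Yrest i j ≈ []
    top i j i<p a≤j = ≈-trans (≈-reflexive (trans (rowPart-≢ (∁? atC₁?) i₁ Y j (i≢i₁ i i<p)) (Y≡X i j)))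
      (upperZeroℕ (ρ i) (κ j) (ℕP.≤-<-trans (toℕ-ρ-≤ i) (s≤s i<p)) (ℕP.≤-trans a≤j (toℕ-κ-≥′ j)) (λ eq _ → ρ≢r i eq))
    bottom : ∀ i j → p ≤ toℕ i → toℕ j < a → Yrest i j ≈ []
    bottom i j p≤i j<a = byCase (i ≟ i₁) (j ≟ c₁)
      where
      byCase : Dec (i ≡ i₁) → Dec (j ≡ c₁) → Yrest i j ≈ []
      byCase (yes i≡i₁) (yes j≡c₁) = ≈-reflexive (rowPart-∉ (∁? atC₁?) i₁ Y i≡i₁ (λ j≢c₁ → j≢c₁ j≡c₁))
      byCase (yes i≡i₁) (no j≢c₁) = ≈-trans (≈-reflexive (trans (rowPart-∈ (∁? atC₁?) i₁ Y i j≢c₁) (Y≡X i j)))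
        (lowerZeroℕ (ρ i) (κ j) (ρ-≥ i p≤i) (κ-< j j<a)
          (λ _ eq → j≢c₁ (FinP.toℕ-injective (trans (trans (sym (toℕ-κ-< j (ℕP.<-≤-trans j<a (ℕP.m≤m+n a (toℕ f))))) eq)
                                                    (sym toℕ-c₁)))))
      byCase (no i≢i₁) _ = ≈-trans (≈-reflexive (trans (rowPart-≢ (∁? atC₁?) i₁ Y j i≢i₁) (Y≡X i j)))
        (lowerZeroℕ (ρ i) (κ j) (ρ-≥ i p≤i) (κ-< j j<a)
          (λ eq _ → i≢i₁ (FinP.toℕ-injective (trans (ℕP.suc-injective (trans (sym (toℕ-ρ-≥ i (ℕP.≤-trans r≤p p≤i))) eq))
                                                    (sym toℕ-i₁)))))

  Z : Mat n₀
  Z = minor Yc i₁ c₁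

  ρ′ κ′ : Fin n₀ → Fin (a + b)
  ρ′ i = ρ (punchIn i₁ i)
  κ′ j = κ (punchIn c₁ j)

  Z≡X : ∀ i j → Z i j ≡ X (ρ′ i) (κ′ j)
  Z≡X i j = trans (rowPart-≢ atC₁? i₁ Y (punchIn c₁ j) (FinP.punchInᵢ≢i i₁ i)) (Y≡X (punchIn i₁ i) (punchIn c₁ j))

  toℕ-punchIn-i₁ : ∀ x → toℕ (punchIn i₁ (x ↑ˡ q)) ≡ toℕ x
  toℕ-punchIn-i₁ x = trans (toℕ-punchIn-< i₁ (x ↑ˡ q) (subst₂ _<_ (sym (FinP.toℕ-↑ˡ x q)) (sym toℕ-i₁)
    (ℕP.<-≤-trans (FinP.toℕ<n x) (ℕP.m≤m+n p (toℕ f))))) (FinP.toℕ-↑ˡ x q)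

  toℕ-punchIn-c₁ : ∀ y → toℕ (punchIn c₁ (p ↑ʳ y)) ≡ suc (p + toℕ y)
  toℕ-punchIn-c₁ y = trans (toℕ-punchIn-≥ c₁ (p ↑ʳ y) (subst₂ _≤_ (sym toℕ-c₁) (sym (FinP.toℕ-↑ʳ p y))
    (ℕP.≤-trans r≤p (ℕP.m≤m+n p (toℕ y))))) (cong suc (FinP.toℕ-↑ʳ p y))

  Z-upper : ∀ x y → Z (x ↑ˡ q) (p ↑ʳ y) ≈ []
  Z-upper x y = ≈-trans (≈-reflexive (Z≡X (x ↑ˡ q) (p ↑ʳ y))) (upperZeroℕ _ _
    (ℕP.≤-<-trans (toℕ-ρ-≤ (punchIn i₁ (x ↑ˡ q))) (s≤s (subst (_< p) (sym (toℕ-punchIn-i₁ x)) (FinP.toℕ<n x))))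
    (ℕP.≤-trans (subst (a ≤_) (sym (toℕ-punchIn-c₁ y)) (s≤s (ℕP.m≤m+n p (toℕ y)))) (toℕ-κ-≥′ (punchIn c₁ (p ↑ʳ y))))
    (λ eq _ → ρ≢r (punchIn i₁ (x ↑ˡ q)) eq))

  Z-left : ∀ x y → Z (x ↑ˡ q) (y ↑ˡ q) ≡ minor A r r x y
  Z-left x y = trans (Z≡X (x ↑ˡ q) (y ↑ˡ q)) (cong₂ X (FinP.toℕ-injective row) (FinP.toℕ-injective col))
    where
    row : toℕ (ρ′ (x ↑ˡ q)) ≡ toℕ (punchIn r x ↑ˡ b)
    row with toℕ x <? toℕ r
    ... | yes lt = trans (toℕ-ρ-< _ (subst (_< toℕ r) (sym (toℕ-punchIn-i₁ x)) lt))
                    (trans (toℕ-punchIn-i₁ x) (sym (trans (FinP.toℕ-↑ˡ (punchIn r x) b) (toℕ-punchIn-< r x lt))))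
    ... | no ge = trans (toℕ-ρ-≥ _ (subst (toℕ r ≤_) (sym (toℕ-punchIn-i₁ x)) (ℕP.≮⇒≥ ge)))
                    (trans (cong suc (toℕ-punchIn-i₁ x))
                           (sym (trans (FinP.toℕ-↑ˡ (punchIn r x) b) (toℕ-punchIn-≥ r x (ℕP.≮⇒≥ ge)))))
    w = punchIn c₁ (y ↑ˡ q)
    toℕ-w : toℕ w ≡ toℕ (punchIn r y)
    toℕ-w with toℕ y <? toℕ r
    ... | yes lt = trans (toℕ-punchIn-< c₁ (y ↑ˡ q) (subst₂ _<_ (sym (FinP.toℕ-↑ˡ y q)) (sym toℕ-c₁) lt))
                     (trans (FinP.toℕ-↑ˡ y q) (sym (toℕ-punchIn-< r y lt)))
    ... | no ge = trans (toℕ-punchIn-≥ c₁ (y ↑ˡ q) (subst₂ _≤_ (sym toℕ-c₁) (sym (FinP.toℕ-↑ˡ y q)) (ℕP.≮⇒≥ ge)))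
                     (trans (cong suc (FinP.toℕ-↑ˡ y q)) (sym (toℕ-punchIn-≥ r y (ℕP.≮⇒≥ ge))))
    col : toℕ (κ′ (y ↑ˡ q)) ≡ toℕ (punchIn r y ↑ˡ b)
    col = trans (toℕ-κ-< w (ℕP.<-≤-trans (subst (_< a) (sym toℕ-w) (FinP.toℕ<n (punchIn r y))) (ℕP.m≤m+n a (toℕ f))))
             (trans toℕ-w (sym (FinP.toℕ-↑ˡ (punchIn r y) b)))

  Z-right : ∀ x y → Z (p ↑ʳ x) (p ↑ʳ y) ≡ minor D f f x y
  Z-right x y = trans (Z≡X (p ↑ʳ x) (p ↑ʳ y)) (cong₂ X (FinP.toℕ-injective row) (FinP.toℕ-injective col))
    where
    w = punchIn i₁ (p ↑ʳ x)
    toℕ-w : toℕ w ≡ p + toℕ (punchIn f x)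
    toℕ-w with toℕ x <? toℕ f
    ... | yes lt = trans (toℕ-punchIn-< i₁ (p ↑ʳ x) (subst₂ _<_ (sym (FinP.toℕ-↑ʳ p x)) (sym toℕ-i₁) (ℕP.+-monoʳ-< p lt)))
                     (trans (FinP.toℕ-↑ʳ p x) (cong (p +_) (sym (toℕ-punchIn-< f x lt))))
    ... | no ge = trans (toℕ-punchIn-≥ i₁ (p ↑ʳ x) (subst₂ _≤_ (sym toℕ-i₁) (sym (FinP.toℕ-↑ʳ p x)) (ℕP.+-monoʳ-≤ p (ℕP.≮⇒≥ ge))))
                     (trans (cong suc (FinP.toℕ-↑ʳ p x))
                     (trans (sym (ℕP.+-suc p (toℕ x))) (cong (p +_) (sym (toℕ-punchIn-≥ f x (ℕP.≮⇒≥ ge))))))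
    row : toℕ (ρ′ (p ↑ʳ x)) ≡ toℕ (a ↑ʳ punchIn f x)
    row = trans (toℕ-ρ-≥ w (subst (toℕ r ≤_) (sym toℕ-w) (ℕP.≤-trans r≤p (ℕP.m≤m+n p _))))
            (trans (cong suc toℕ-w) (sym (FinP.toℕ-↑ʳ a (punchIn f x))))
    w′ = punchIn c₁ (p ↑ʳ y)
    col : toℕ (κ′ (p ↑ʳ y)) ≡ toℕ (a ↑ʳ punchIn f y)
    col with toℕ y <? toℕ f
    ... | yes lt = trans (toℕ-κ-< w′ (subst (_< a + toℕ f) (sym (toℕ-punchIn-c₁ y)) (s≤s (ℕP.+-monoʳ-< p lt))))
                     (trans (toℕ-punchIn-c₁ y) (sym (trans (FinP.toℕ-↑ʳ a (punchIn f y))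
                       (cong (λ z → suc (p + z)) (toℕ-punchIn-< f y lt)))))
    ... | no ge = trans (toℕ-κ-≥ w′ (subst (a + toℕ f ≤_) (sym (toℕ-punchIn-c₁ y)) (s≤s (ℕP.+-monoʳ-≤ p (ℕP.≮⇒≥ ge)))))
                     (trans (cong suc (toℕ-punchIn-c₁ y)) (sym (trans (FinP.toℕ-↑ʳ a (punchIn f y))
                       (trans (cong (λ z → suc (p + z)) (toℕ-punchIn-≥ f y (ℕP.≮⇒≥ ge))) (cong suc (ℕP.+-suc p (toℕ y)))))))

  det-Z : det n₀ Z ≈ det p (minor A r r) *P det q (minor D f f)
  det-Z = ≈-trans (det-blockTriangular p q Z Z-upper)
    (*P-cong (det-cong p λ i j → ≈-reflexive (Z-left i j)) (det-cong q λ i j → ≈-reflexive (Z-right i j)))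

  det-Yc : det (suc n₀) Yc ≈ signP (toℕ i₁ + toℕ c₁) (v *P (det p (minor A r r) *P det q (minor D f f)))
  det-Yc = ≈-trans
    (det-singleEntryRow n₀ Yc i₁ c₁ (λ c c≢c₁ → ≈-reflexive (rowPart-∉ atC₁? i₁ Y refl c≢c₁)))
    (signP-cong (toℕ i₁ + toℕ c₁) (*P-cong (≈-trans (≈-reflexive (rowPart-∈ atC₁? i₁ Y i₁ refl)) Y-v) det-Z))

  det-keepRight : det (a + b) keepRight ≈ negP (u *P v *P det p (minor A r r) *P det q (minor D f f))
  det-keepRight =
    ≈-trans det-keepRight-expand
    (≈-trans (signP-cong s₁ (*P-congˡ u (≈-trans (det-rowPart n₀ atC₁? i₁ Y)
                                         (≈-trans (+P-congˡ (det (suc n₀) Yc) det-Yrest) (+P-identityʳ _)))))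
    (≈-trans (signP-cong s₁ (*P-congˡ u det-Yc))
    (≈-trans (signP-cong s₁ (signP-distribˡ-*P s₂ u w))
    (≈-trans (≈-reflexive (sym (signP-+ s₁ s₂ (u *P w))))
    (≈-trans (signP-≡ (u *P w) odd)
    (≈-trans (signP-even t 1 (u *P w))
             (reassoc u v (det p (minor A r r)) (det q (minor D f f)))))))))
    where
    s₁ = toℕ k₀ + toℕ j₀
    s₂ = toℕ i₁ + toℕ c₁
    t  = toℕ r + p + toℕ f
    w  = v *P (det p (minor A r r) *P det q (minor D f f))
    odd : s₁ + s₂ ≡ t + t + 1
    odd = trans (cong₂ _+_ (cong₂ _+_ toℕ-k₀ toℕ-j₀) (cong₂ _+_ toℕ-i₁ toℕ-c₁)) (shuffle (toℕ r) p (toℕ f))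
      where
      shuffle : ∀ r p f → (r + (suc p + f)) + ((p + f) + r) ≡ (r + p + f) + (r + p + f) + 1
      shuffle = solve-ℕ
    reassoc : ∀ u v x y → negP (u *P (v *P (x *P y))) ≈ negP (u *P v *P x *P y)
    reassoc = solve-∀ ℤ[x]-almost

  det-bridged : det (a + b) X ≈ det a A *P det b D +P negP (u *P v *P det p (minor A r r) *P det q (minor D f f))
  det-bridged = ≈-trans (det-rowPart (p + b) inLeft? k₀ X) (+P-cong det-keepLeft det-keepRight)

-- Characteristic polynomials of glued graphs

charMat : ∀ {n} → Graph n → Mat n
charMat H i j = if ⌊ i ≟ j ⌋ then xP else (if adj H i j then negP oneP else [])

isYes-≟-cong : ∀ {m n} {i j : Fin m} {i′ j′ : Fin n} →
  (i ≡ j → i′ ≡ j′) → (i′ ≡ j′ → i ≡ j) → ⌊ i ≟ j ⌋ ≡ ⌊ i′ ≟ j′ ⌋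
isYes-≟-cong {i = i} {j} {i′} {j′} to from with i ≟ j | i′ ≟ j′
... | yes _   | yes _    = refl
... | yes eq  | no  ne   = ⊥-elim (ne (to eq))
... | no  ne  | yes eq   = ⊥-elim (ne (from eq))
... | no  _   | no  _    = refl

isYes-≟-refl : ∀ {m} (i : Fin m) → ⌊ i ≟ i ⌋ ≡ true
isYes-≟-refl i = trans (isYes≗does (i ≟ i)) (dec-true (i ≟ i) refl)

isYes-≢ : ∀ {m} {i j : Fin m} → i ≢ j → ⌊ i ≟ j ⌋ ≡ false
isYes-≢ {i = i} {j} i≢j = trans (isYes≗does (i ≟ j)) (dec-false (i ≟ j) i≢j)

charMat-cong : ∀ {m n} (G : Graph m) (G′ : Graph n) {i j : Fin m} {i′ j′ : Fin n} →
  ⌊ i ≟ j ⌋ ≡ ⌊ i′ ≟ j′ ⌋ → adj G i j ≡ adj G′ i′ j′ → charMat G i j ≡ charMat G′ i′ j′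
charMat-cong G G′ diag edge rewrite diag | edge = refl

charMat-nonEdge : ∀ {m} (G : Graph m) {i j : Fin m} → i ≢ j → adj G i j ≡ false → charMat G i j ≡ []
charMat-nonEdge G i≢j noEdge rewrite isYes-≢ i≢j | noEdge = refl

charMat-edge : ∀ {m} (G : Graph m) {i j : Fin m} → i ≢ j → adj G i j ≡ true → charMat G i j ≡ negP oneP
charMat-edge G i≢j edge rewrite isYes-≢ i≢j | edge = refl

charMat-del : ∀ {k} (G : Graph (suc k)) v i j → charMat (del G v) i j ≡ charMat G (punchIn v i) (punchIn v j)
charMat-del G v i j = charMat-cong (del G v) G (isYes-≟-cong (cong (punchIn v)) (FinP.punchIn-injective v i j)) refl

-- Graph isomorphisms that merely reindex along an equation of sizes.
infix 4 _≅_
record _≅_ {m n} (G : Graph m) (G′ : Graph n) : Set where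
  field
    size     : m ≡ n
    adj-cast : ∀ i j → adj G i j ≡ adj G′ (cast size i) (cast size j)
open _≅_

cast-injective : ∀ {m n} (e : m ≡ n) {i j : Fin m} → cast e i ≡ cast e j → i ≡ j
cast-injective e {i} {j} eq =
  FinP.toℕ-injective (trans (sym (FinP.toℕ-cast e i)) (trans (cong toℕ eq) (FinP.toℕ-cast e j)))

φ-≅ : ∀ {m n} {G : Graph m} {G′ : Graph n} → G ≅ G′ → φ G ≈ φ G′
φ-≅ {m} {G = G} {G′} iso =
  ≈-trans (det-cong m λ i j → ≈-reflexive
             (charMat-cong G G′ (isYes-≟-cong (cong (cast (size iso))) (cast-injective (size iso))) (adj-cast iso i j)))
          (det-cast (size iso) (charMat G′))

≅-trans : ∀ {m n o} {G : Graph m} {G′ : Graph n} {G″ : Graph o} → G ≅ G′ → G′ ≅ G″ → G ≅ G″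
≅-trans {G″ = G″} iso₁ iso₂ = record
  { size     = trans (size iso₁) (size iso₂)
  ; adj-cast = λ i j → trans (adj-cast iso₁ i j)
      (trans (adj-cast iso₂ (cast (size iso₁) i) (cast (size iso₁) j)) (cong₂ (adj G″) (cast-trans i) (cast-trans j))) }
  where
  cast-trans : ∀ i → cast (size iso₂) (cast (size iso₁) i) ≡ cast (trans (size iso₁) (size iso₂)) i
  cast-trans i = FinP.toℕ-injective (trans (FinP.toℕ-cast (size iso₂) _)
    (trans (FinP.toℕ-cast (size iso₁) i) (sym (FinP.toℕ-cast (trans (size iso₁) (size iso₂)) i))))

φ-blocks : ∀ {a b} (G : Graph (a + b)) (H : Graph a) (C : Graph b) →
  (∀ x y → adj G (x ↑ˡ b) (y ↑ˡ b) ≡ adj H x y) → (∀ x y → adj G (a ↑ʳ x) (a ↑ʳ y) ≡ adj C x y) →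
  (∀ x y → adj G (x ↑ˡ b) (a ↑ʳ y) ≡ false) → φ G ≈ φ H *P φ C
φ-blocks {a} {b} G H C leftBlock rightBlock noBridge = ≈-trans
  (det-blockTriangular a b (charMat G) λ x y → ≈-reflexive (charMat-nonEdge G (↑ˡ≢↑ʳ x y) (noBridge x y)))
  (*P-cong (det-cong a λ x y → ≈-reflexive (charMat-cong G H (isYes-≟-cong (FinP.↑ˡ-injective b x y) (cong (_↑ˡ b))) (leftBlock x y)))
           (det-cong b λ x y → ≈-reflexive (charMat-cong G C (isYes-≟-cong (FinP.↑ʳ-injective a x y) (cong (a ↑ʳ_))) (rightBlock x y))))

module Glued {a b : ℕ} (H : Graph a) (r : Fin a) (C : Graph b) (f : Fin b) where

  G : Graph (a + b)
  G = glue H r C f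

  adj-left : ∀ x y → adj G (x ↑ˡ b) (y ↑ˡ b) ≡ adj H x y
  adj-left x y rewrite FinP.splitAt-↑ˡ a x b | FinP.splitAt-↑ˡ a y b = refl

  adj-right : ∀ x y → adj G (a ↑ʳ x) (a ↑ʳ y) ≡ adj C x y
  adj-right x y rewrite FinP.splitAt-↑ʳ a b x | FinP.splitAt-↑ʳ a b y = refl

  adj-bridge : ∀ x y → adj G (x ↑ˡ b) (a ↑ʳ y) ≡ ⌊ x ≟ r ⌋ ∧ ⌊ y ≟ f ⌋
  adj-bridge x y rewrite FinP.splitAt-↑ˡ a x b | FinP.splitAt-↑ʳ a b y = refl

  adj-bridge′ : ∀ x y → adj G (a ↑ʳ y) (x ↑ˡ b) ≡ ⌊ x ≟ r ⌋ ∧ ⌊ y ≟ f ⌋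
  adj-bridge′ x y rewrite FinP.splitAt-↑ˡ a x b | FinP.splitAt-↑ʳ a b y = refl

  charMat-left : ∀ x y → charMat G (x ↑ˡ b) (y ↑ˡ b) ≡ charMat H x y
  charMat-left x y = charMat-cong G H (isYes-≟-cong (FinP.↑ˡ-injective b x y) (cong (_↑ˡ b))) (adj-left x y)

  charMat-right : ∀ x y → charMat G (a ↑ʳ x) (a ↑ʳ y) ≡ charMat C x y
  charMat-right x y = charMat-cong G C (isYes-≟-cong (FinP.↑ʳ-injective a x y) (cong (a ↑ʳ_))) (adj-right x y)

  no-bridge : ∀ {x y} → ¬ (x ≡ r × y ≡ f) → ⌊ x ≟ r ⌋ ∧ ⌊ y ≟ f ⌋ ≡ false
  no-bridge {x} {y} ¬bridge with x ≟ r | y ≟ f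
  ... | yes x≡r | yes y≡f = ⊥-elim (¬bridge (x≡r , y≡f))
  ... | yes _   | no _    = refl
  ... | no _    | _       = refl

  charMat-upper : ∀ x y → ¬ (x ≡ r × y ≡ f) → charMat G (x ↑ˡ b) (a ↑ʳ y) ≈ []
  charMat-upper x y ¬bridge = ≈-reflexive (charMat-nonEdge G (↑ˡ≢↑ʳ x y) (trans (adj-bridge x y) (no-bridge ¬bridge)))

  charMat-lower : ∀ x y → ¬ (x ≡ r × y ≡ f) → charMat G (a ↑ʳ y) (x ↑ˡ b) ≈ []
  charMat-lower x y ¬bridge = ≈-reflexive (charMat-nonEdge G (↑ˡ≢↑ʳ x y ∘ sym) (trans (adj-bridge′ x y) (no-bridge ¬bridge)))

  bridge-true : ⌊ r ≟ r ⌋ ∧ ⌊ f ≟ f ⌋ ≡ true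
  bridge-true = cong₂ _∧_ (isYes-≟-refl r) (isYes-≟-refl f)

  charMat-bridge : charMat G (r ↑ˡ b) (a ↑ʳ f) ≡ negP oneP
  charMat-bridge = charMat-edge G (↑ˡ≢↑ʳ r f) (trans (adj-bridge r f) bridge-true)

  charMat-bridge′ : charMat G (a ↑ʳ f) (r ↑ˡ b) ≡ negP oneP
  charMat-bridge′ = charMat-edge G (↑ˡ≢↑ʳ r f ∘ sym) (trans (adj-bridge′ r f) bridge-true)

φ-glue : ∀ {p q} (H : Graph (suc p)) r (C : Graph (suc q)) f →
  φ (glue H r C f) ≈ φ H *P φ C +P negP (φ (del H r) *P φ (del C f))
φ-glue {p} {q} H r C f =
  ≈-trans (BridgedBlocks.det-bridged (charMat G) r f charMat-upper charMat-lower)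
    (+P-cong (*P-cong (det-cong (suc p) λ i j → ≈-reflexive (charMat-left i j))
                      (det-cong (suc q) λ i j → ≈-reflexive (charMat-right i j)))
             (negP-cong (≈-trans
               (*P-cong (*P-cong (*P-cong (≈-reflexive charMat-bridge) (≈-reflexive charMat-bridge′))
                                 (det-cong p λ i j → ≈-reflexive (trans (charMat-left (punchIn r i) (punchIn r j))
                                                                        (sym (charMat-del H r i j)))))
                        (det-cong q λ i j → ≈-reflexive (trans (charMat-right (punchIn f i) (punchIn f j))
                                                               (sym (charMat-del C f i j)))))
               (unit-square (φ (del H r)) (φ (del C f))))))
  where
  open Glued H r C f
  unit-square : ∀ x y → negP oneP *P negP oneP *P x *P y ≈ x *P y
  unit-square = solve-∀ ℤ[x]-almost

φ-glue-delRoot : ∀ {p b} (H : Graph (suc p)) r (C : Graph b) f →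
  φ (del (glue H r C f) (r ↑ˡ b)) ≈ φ (del H r) *P φ C
φ-glue-delRoot {p} {b} H r C f = φ-blocks (del G (r ↑ˡ b)) (del H r) C
  (λ x y → trans (cong₂ (adj G) (punchIn-↑ˡ-↑ˡ b r x) (punchIn-↑ˡ-↑ˡ b r y)) (adj-left (punchIn r x) (punchIn r y)))
  (λ x y → trans (cong₂ (adj G) (punchIn-↑ˡ-↑ʳ b r x) (punchIn-↑ˡ-↑ʳ b r y)) (adj-right x y))
  (λ x y → trans (cong₂ (adj G) (punchIn-↑ˡ-↑ˡ b r x) (punchIn-↑ˡ-↑ʳ b r y))
                 (trans (adj-bridge (punchIn r x) y) (no-bridge (λ (eq , _) → FinP.punchInᵢ≢i r x eq))))
  where open Glued H r C f

private
  blocks : ∀ {a b} → Graph a → Graph b → Fin a ⊎ Fin b → Fin a ⊎ Fin b → Bool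
  blocks H D (inj₁ x) (inj₁ y) = adj H x y
  blocks H D (inj₂ x) (inj₂ y) = adj D x y
  blocks H D (inj₁ x) (inj₂ y) = false
  blocks H D (inj₂ x) (inj₁ y) = false

  blocks-sym : ∀ {a b} (H : Graph a) (D : Graph b) s t → blocks H D s t ≡ blocks H D t s
  blocks-sym H D (inj₁ x) (inj₁ y) = Defs.sym H x y
  blocks-sym H D (inj₂ x) (inj₂ y) = Defs.sym D x y
  blocks-sym H D (inj₁ x) (inj₂ y) = refl
  blocks-sym H D (inj₂ x) (inj₁ y) = refl

  blocks-irrefl : ∀ {a b} (H : Graph a) (D : Graph b) s → blocks H D s s ≡ false
  blocks-irrefl H D (inj₁ x) = irrefl H x
  blocks-irrefl H D (inj₂ x) = irrefl D x

infixr 5 _⊕_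
_⊕_ : ∀ {a b} → Graph a → Graph b → Graph (a + b)
_⊕_ {a} H D = record
  { adj    = λ u v → blocks H D (splitAt a u) (splitAt a v)
  ; sym    = λ u v → blocks-sym H D (splitAt a u) (splitAt a v)
  ; irrefl = λ u → blocks-irrefl H D (splitAt a u) }

module _ {a b : ℕ} (H : Graph a) (D : Graph b) where

  ⊕-adj-left : ∀ x y → adj (H ⊕ D) (x ↑ˡ b) (y ↑ˡ b) ≡ adj H x y
  ⊕-adj-left x y rewrite FinP.splitAt-↑ˡ a x b | FinP.splitAt-↑ˡ a y b = refl

  ⊕-adj-right : ∀ x y → adj (H ⊕ D) (a ↑ʳ x) (a ↑ʳ y) ≡ adj D x y
  ⊕-adj-right x y rewrite FinP.splitAt-↑ʳ a b x | FinP.splitAt-↑ʳ a b y = refl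

  ⊕-adj-cross : ∀ x y → adj (H ⊕ D) (x ↑ˡ b) (a ↑ʳ y) ≡ false
  ⊕-adj-cross x y rewrite FinP.splitAt-↑ˡ a x b | FinP.splitAt-↑ʳ a b y = refl

  ⊕-adj-cross′ : ∀ x y → adj (H ⊕ D) (a ↑ʳ y) (x ↑ˡ b) ≡ false
  ⊕-adj-cross′ x y rewrite FinP.splitAt-↑ˡ a x b | FinP.splitAt-↑ʳ a b y = refl

  φ-⊕ : φ (H ⊕ D) ≈ φ H *P φ D
  φ-⊕ = φ-blocks (H ⊕ D) H D ⊕-adj-left ⊕-adj-right ⊕-adj-cross

φ-⊕-delLeft : ∀ {p b} (H : Graph (suc p)) r (D : Graph b) → φ (del (H ⊕ D) (r ↑ˡ b)) ≈ φ (del H r) *P φ D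
φ-⊕-delLeft {p} {b} H r D = φ-blocks (del (H ⊕ D) (r ↑ˡ b)) (del H r) D
  (λ x y → trans (cong₂ (adj (H ⊕ D)) (punchIn-↑ˡ-↑ˡ b r x) (punchIn-↑ˡ-↑ˡ b r y)) (⊕-adj-left H D (punchIn r x) (punchIn r y)))
  (λ x y → trans (cong₂ (adj (H ⊕ D)) (punchIn-↑ˡ-↑ʳ b r x) (punchIn-↑ˡ-↑ʳ b r y)) (⊕-adj-right H D x y))
  (λ x y → trans (cong₂ (adj (H ⊕ D)) (punchIn-↑ˡ-↑ˡ b r x) (punchIn-↑ˡ-↑ʳ b r y)) (⊕-adj-cross H D (punchIn r x) y))

glue-≅ : ∀ {a m n} (H : Graph a) (r : Fin a) {C : Graph m} {C′ : Graph n} {f : Fin m} {f′ : Fin n} →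
  (iso : C ≅ C′) → toℕ f ≡ toℕ f′ → glue H r C f ≅ glue H r C′ f′
glue-≅ {a} {m} {n} H r {C} {C′} {f} {f′} iso f≡f′ = record { size = cong (a +_) (size iso) ; adj-cast = adj≡ }
  where
  module G  = Glued H r C f
  module G′ = Glued H r C′ f′
  e = cong (a +_) (size iso)
  cast-left : ∀ x → cast e (x ↑ˡ m) ≡ x ↑ˡ n
  cast-left x = FinP.toℕ-injective (trans (FinP.toℕ-cast e (x ↑ˡ m)) (trans (FinP.toℕ-↑ˡ x m) (sym (FinP.toℕ-↑ˡ x n))))
  cast-right : ∀ y → cast e (a ↑ʳ y) ≡ a ↑ʳ cast (size iso) y
  cast-right y = FinP.toℕ-injective (trans (FinP.toℕ-cast e (a ↑ʳ y)) (trans (FinP.toℕ-↑ʳ a y)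
    (sym (trans (FinP.toℕ-↑ʳ a (cast (size iso) y)) (cong (a +_) (FinP.toℕ-cast (size iso) y))))))
  at-f : ∀ y → ⌊ y ≟ f ⌋ ≡ ⌊ cast (size iso) y ≟ f′ ⌋
  at-f y = isYes-≟-cong
    (λ eq → FinP.toℕ-injective (trans (FinP.toℕ-cast (size iso) y) (trans (cong toℕ eq) f≡f′)))
    (λ eq → FinP.toℕ-injective (trans (sym (FinP.toℕ-cast (size iso) y)) (trans (cong toℕ eq) (sym f≡f′))))
  go : ∀ {i j} → BlockView a m i → BlockView a m j → adj G.G i j ≡ adj G′.G (cast e i) (cast e j)
  go (left x)  (left y)  = trans (G.adj-left x y) (sym (trans (cong₂ (adj G′.G) (cast-left x) (cast-left y)) (G′.adj-left x y)))
  go (left x)  (right y) = trans (G.adj-bridge x y) (sym (trans (cong₂ (adj G′.G) (cast-left x) (cast-right y))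
    (trans (G′.adj-bridge x (cast (size iso) y)) (cong (⌊ x ≟ r ⌋ ∧_) (sym (at-f y))))))
  go (right y) (left x)  = trans (G.adj-bridge′ x y) (sym (trans (cong₂ (adj G′.G) (cast-right y) (cast-left x))
    (trans (G′.adj-bridge′ x (cast (size iso) y)) (cong (⌊ x ≟ r ⌋ ∧_) (sym (at-f y))))))
  go (right x) (right y) = trans (G.adj-right x y)
    (trans (adj-cast iso x y) (sym (trans (cong₂ (adj G′.G) (cast-right x) (cast-right y)) (G′.adj-right _ _))))
  adj≡ : ∀ i j → adj G.G i j ≡ adj G′.G (cast e i) (cast e j)
  adj≡ i j = go (blockView a m i) (blockView a m j)

module DeleteRight {p n : ℕ} (H : Graph (suc p)) (r : Fin (suc p)) (C : Graph (suc n)) (f ℓ : Fin (suc n)) where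

  open Glued H r C f

  size′ : p + suc n ≡ suc p + n
  size′ = ℕP.+-suc p n

  v : Fin (suc p + suc n)
  v = suc p ↑ʳ ℓ

  punchIn-left : ∀ i x → cast size′ i ≡ x ↑ˡ n → punchIn v i ≡ x ↑ˡ suc n
  punchIn-left i x eq = FinP.toℕ-injective (trans (toℕ-punchIn-< v i i<v) (trans i≡x (sym (FinP.toℕ-↑ˡ x (suc n)))))
    where
    i≡x : toℕ i ≡ toℕ x
    i≡x = trans (sym (FinP.toℕ-cast size′ i)) (trans (cong toℕ eq) (FinP.toℕ-↑ˡ x n))
    i<v : toℕ i < toℕ v
    i<v = subst (_< toℕ v) (sym i≡x) (subst (toℕ x <_) (sym (FinP.toℕ-↑ʳ (suc p) ℓ))
            (ℕP.<-≤-trans (FinP.toℕ<n x) (ℕP.m≤m+n (suc p) (toℕ ℓ))))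

  punchIn-right : ∀ i y → cast size′ i ≡ suc p ↑ʳ y → punchIn v i ≡ suc p ↑ʳ punchIn ℓ y
  punchIn-right i y eq with toℕ y <? toℕ ℓ
  ... | yes y<ℓ = FinP.toℕ-injective (trans (toℕ-punchIn-< v i (subst₂ _<_ (sym i≡) (sym (FinP.toℕ-↑ʳ (suc p) ℓ)) (ℕP.+-monoʳ-< (suc p) y<ℓ)))
      (trans i≡ (sym (trans (FinP.toℕ-↑ʳ (suc p) (punchIn ℓ y)) (cong (suc p +_) (toℕ-punchIn-< ℓ y y<ℓ))))))
    where
    i≡ : toℕ i ≡ suc p + toℕ y
    i≡ = trans (sym (FinP.toℕ-cast size′ i)) (trans (cong toℕ eq) (FinP.toℕ-↑ʳ (suc p) y))
  ... | no y≮ℓ = FinP.toℕ-injective (trans (toℕ-punchIn-≥ v i (subst₂ _≤_ (sym (FinP.toℕ-↑ʳ (suc p) ℓ)) (sym i≡) (ℕP.+-monoʳ-≤ (suc p) (ℕP.≮⇒≥ y≮ℓ))))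
      (trans (cong suc i≡) (sym (trans (FinP.toℕ-↑ʳ (suc p) (punchIn ℓ y))
        (trans (cong (suc p +_) (toℕ-punchIn-≥ ℓ y (ℕP.≮⇒≥ y≮ℓ))) (ℕP.+-suc (suc p) (toℕ y)))))))
    where
    i≡ : toℕ i ≡ suc p + toℕ y
    i≡ = trans (sym (FinP.toℕ-cast size′ i)) (trans (cong toℕ eq) (FinP.toℕ-↑ʳ (suc p) y))

  byBlocks : ∀ (G′ : Graph (suc p + n)) →
    (∀ x y → adj G (x ↑ˡ suc n) (y ↑ˡ suc n) ≡ adj G′ (x ↑ˡ n) (y ↑ˡ n)) →
    (∀ x y → adj G (x ↑ˡ suc n) (suc p ↑ʳ punchIn ℓ y) ≡ adj G′ (x ↑ˡ n) (suc p ↑ʳ y)) →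
    (∀ x y → adj G (suc p ↑ʳ punchIn ℓ y) (x ↑ˡ suc n) ≡ adj G′ (suc p ↑ʳ y) (x ↑ˡ n)) →
    (∀ x y → adj G (suc p ↑ʳ punchIn ℓ x) (suc p ↑ʳ punchIn ℓ y) ≡ adj G′ (suc p ↑ʳ x) (suc p ↑ʳ y)) →
    del G v ≅ G′
  byBlocks G′ ll lr rl rr = record
    { size = size′ ; adj-cast = λ i j → go i j (blockView (suc p) n (cast size′ i)) (blockView (suc p) n (cast size′ j)) refl refl }
    where
    go : ∀ i j {s t} → BlockView (suc p) n s → BlockView (suc p) n t → cast size′ i ≡ s → cast size′ j ≡ t →
         adj G (punchIn v i) (punchIn v j) ≡ adj G′ s t
    go i j (left x)  (left y)  ei ej = trans (cong₂ (adj G) (punchIn-left i x ei) (punchIn-left j y ej)) (ll x y)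
    go i j (left x)  (right y) ei ej = trans (cong₂ (adj G) (punchIn-left i x ei) (punchIn-right j y ej)) (lr x y)
    go i j (right x) (left y)  ei ej = trans (cong₂ (adj G) (punchIn-right i x ei) (punchIn-left j y ej)) (rl y x)
    go i j (right x) (right y) ei ej = trans (cong₂ (adj G) (punchIn-right i x ei) (punchIn-right j y ej)) (rr x y)

  del-glue-≢ : (ℓ≢f : ℓ ≢ f) → del G v ≅ glue H r (del C ℓ) (punchOut ℓ≢f)
  del-glue-≢ ℓ≢f = byBlocks (glue H r (del C ℓ) (punchOut ℓ≢f))
    (λ x y → trans (adj-left x y) (sym (G′.adj-left x y)))
    (λ x y → trans (adj-bridge x (punchIn ℓ y)) (trans (cong (⌊ x ≟ r ⌋ ∧_) (at-f y)) (sym (G′.adj-bridge x y))))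
    (λ x y → trans (adj-bridge′ x (punchIn ℓ y)) (trans (cong (⌊ x ≟ r ⌋ ∧_) (at-f y)) (sym (G′.adj-bridge′ x y))))
    (λ x y → trans (adj-right (punchIn ℓ x) (punchIn ℓ y)) (sym (G′.adj-right x y)))
    where
    module G′ = Glued H r (del C ℓ) (punchOut ℓ≢f)
    at-f : ∀ y → ⌊ punchIn ℓ y ≟ f ⌋ ≡ ⌊ y ≟ punchOut ℓ≢f ⌋
    at-f y = isYes-≟-cong (λ eq → FinP.punchIn-injective ℓ y _ (trans eq (sym (FinP.punchIn-punchOut ℓ≢f))))
                          (λ eq → trans (cong (punchIn ℓ) eq) (FinP.punchIn-punchOut ℓ≢f))

  del-glue-≡ : ℓ ≡ f → del G v ≅ H ⊕ del C ℓ
  del-glue-≡ ℓ≡f = byBlocks (H ⊕ del C ℓ)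
    (λ x y → trans (adj-left x y) (sym (⊕-adj-left H (del C ℓ) x y)))
    (λ x y → trans (adj-bridge x (punchIn ℓ y)) (trans (cong (⌊ x ≟ r ⌋ ∧_) (not-f y)) (trans (∧-zeroʳ _) (sym (⊕-adj-cross H (del C ℓ) x y)))))
    (λ x y → trans (adj-bridge′ x (punchIn ℓ y)) (trans (cong (⌊ x ≟ r ⌋ ∧_) (not-f y)) (trans (∧-zeroʳ _) (sym (⊕-adj-cross′ H (del C ℓ) x y)))))
    (λ x y → trans (adj-right (punchIn ℓ x) (punchIn ℓ y)) (sym (⊕-adj-right H (del C ℓ) x y)))
    where
    not-f : ∀ y → ⌊ punchIn ℓ y ≟ f ⌋ ≡ false
    not-f y = isYes-≢ (λ eq → FinP.punchInᵢ≢i ℓ y (trans eq (sym ℓ≡f)))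

-- Continuants

-- The pair (φ^H, φ^{H∖r}) of a rooted graph (H, r), so that α^H_r = P / Q.
Pair : Set
Pair = Poly × Poly

P Q : Pair → Poly
P = proj₁
Q = proj₂

continuant : ∀ n → Vector Pair n → Poly
continuant zero          g = oneP
continuant (suc zero)    g = P (g zero)
continuant (suc (suc n)) g =
  P (g zero) *P continuant (suc n) (tail g) +P negP (Q (g zero) *P Q (g (suc zero)) *P continuant n (tail (tail g)))

continuant-init : ∀ n (g : Vector Pair (suc (suc n))) →
  continuant (suc (suc n)) g ≈
    P (last g) *P continuant (suc n) (init g) +P negP (Q (init g (fromℕ n)) *P Q (last g) *P continuant n (init (init g)))
continuant-init zero g = reorder (P (g zero)) (P (g (suc zero))) (Q (g zero)) (Q (g (suc zero)))
  where
  reorder : ∀ a b c d → a *P b +P negP (c *P d *P oneP) ≈ b *P a +P negP (c *P d *P oneP)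
  reorder = solve-∀ ℤ[x]-almost
continuant-init (suc zero) g =
  reorder (P (g zero)) (P (g (suc zero))) (P (g (suc (suc zero)))) (Q (g zero)) (Q (g (suc zero))) (Q (g (suc (suc zero))))
  where
  reorder : ∀ p₀ p₁ p₂ q₀ q₁ q₂ → p₀ *P (p₁ *P p₂ +P negP (q₁ *P q₂ *P oneP)) +P negP (q₀ *P q₁ *P p₂)
                                  ≈ p₂ *P (p₀ *P p₁ +P negP (q₀ *P q₁ *P oneP)) +P negP (q₁ *P q₂ *P p₀)
  reorder = solve-∀ ℤ[x]-almost
continuant-init (suc (suc k)) g =
  ≈-trans (+P-cong (*P-congˡ p₀ (continuant-init (suc k) (tail g)))
                   (negP-cong (*P-congˡ (q₀ *P q₁) (continuant-init k (tail (tail g))))))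
    (reorder p₀ q₀ q₁ pₗ qₗ′ qₗ (continuant (suc (suc k)) (init (tail g))) (continuant (suc k) (init (init (tail g))))
             (continuant (suc k) (init (tail (tail g)))) (continuant k (init (init (tail (tail g))))))
  where
  p₀ = P (g zero)
  q₀ = Q (g zero)
  q₁ = Q (g (suc zero))
  pₗ = P (last g)
  qₗ = Q (last g)
  qₗ′ = Q (init g (fromℕ (suc (suc k))))
  reorder : ∀ p₀ q₀ q₁ pₗ qₗ′ qₗ x y z w →
    p₀ *P (pₗ *P x +P negP (qₗ′ *P qₗ *P y)) +P negP (q₀ *P q₁ *P (pₗ *P z +P negP (qₗ′ *P qₗ *P w)))
    ≈ pₗ *P (p₀ *P x +P negP (q₀ *P q₁ *P z)) +P negP (qₗ′ *P qₗ *P (p₀ *P y +P negP (q₀ *P q₁ *P w)))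
  reorder = solve-∀ ℤ[x]-almost

-- x ∼ y says that P x / Q x = P y / Q y, cleared of denominators.
infix 4 _∼_
_∼_ : Pair → Pair → Set
x ∼ y = P x *P Q y ≈ P y *P Q x

opposite-suc-inject₁ : ∀ k (i : Fin (suc (suc k))) →
  opposite {suc (suc (suc (suc k)))} (suc (inject₁ i)) ≡ suc (inject₁ (opposite i))
opposite-suc-inject₁ k i = FinP.toℕ-injective (trans (FinP.opposite-prop (suc (inject₁ i)))
  (trans (cong (λ z → suc (suc (suc k)) ∸ suc z) (FinP.toℕ-inject₁ i))
  (trans (ℕP.+-∸-assoc 1 (FinP.toℕ<n i))
  (sym (trans (cong suc (FinP.toℕ-inject₁ (opposite i))) (cong suc (FinP.opposite-prop i)))))))

continuant-reverse : ∀ n (g : Vector Pair (suc (suc n))) → (∀ i → g i ∼ g (opposite i)) →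
  Q (g zero) *P continuant (suc n) (tail g) ≈ Q (last g) *P continuant (suc n) (init g)
continuant-reverse zero g sym-g = ≈-trans (*P-comm q₀ p₁) (≈-trans (≈-sym (sym-g zero)) (*P-comm p₀ q₁))
  where
  p₀ = P (g zero)
  p₁ = P (g (suc zero))
  q₀ = Q (g zero)
  q₁ = Q (g (suc zero))
continuant-reverse (suc zero) g sym-g =
  ≈-trans (expand p₀ p₁ p₂ q₀ q₁ q₂)
  (≈-trans (+P-congʳ (negP (q₂ *P (q₀ *P q₁ *P oneP))) (*P-congʳ p₁ ends))
           (factor p₀ p₁ p₂ q₀ q₁ q₂))
  where
  p₀ = P (g zero)
  p₁ = P (g (suc zero))
  p₂ = P (g (suc (suc zero)))
  q₀ = Q (g zero)
  q₁ = Q (g (suc zero))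
  q₂ = Q (g (suc (suc zero)))
  ends : q₀ *P p₂ ≈ q₂ *P p₀
  ends = ≈-trans (*P-comm q₀ p₂) (≈-trans (≈-sym (sym-g zero)) (*P-comm p₀ q₂))
  expand : ∀ p₀ p₁ p₂ q₀ q₁ q₂ →
    q₀ *P (p₁ *P p₂ +P negP (q₁ *P q₂ *P oneP)) ≈ q₀ *P p₂ *P p₁ +P negP (q₂ *P (q₀ *P q₁ *P oneP))
  expand = solve-∀ ℤ[x]-almost
  factor : ∀ p₀ p₁ p₂ q₀ q₁ q₂ →
    q₂ *P p₀ *P p₁ +P negP (q₂ *P (q₀ *P q₁ *P oneP)) ≈ q₂ *P (p₀ *P p₁ +P negP (q₀ *P q₁ *P oneP))
  factor = solve-∀ ℤ[x]-almost
continuant-reverse (suc (suc k)) g sym-g =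
  ≈-trans (*P-congˡ q₀ (continuant-init (suc k) (tail g)))
  (≈-trans (expand p₀ q₀ q₁ pₗ qₗ′ qₗ x y z)
  (≈-trans (+P-cong (*P-congʳ x ends) (negP-cong (*P-congˡ (q₀ *P qₗ) inner)))
           (factor p₀ q₀ q₁ pₗ qₗ′ qₗ x y z)))
  where
  p₀ = P (g zero)
  q₀ = Q (g zero)
  q₁ = Q (g (suc zero))
  pₗ = P (last g)
  qₗ = Q (last g)
  qₗ′ = Q (g (suc (inject₁ (fromℕ (suc k)))))
  x = continuant (suc (suc k)) (init (tail g))
  y = continuant (suc k) (init (init (tail g)))
  z = continuant (suc k) (init (tail (tail g)))
  ends : q₀ *P pₗ ≈ qₗ *P p₀
  ends = ≈-trans (*P-comm q₀ pₗ) (≈-trans (≈-sym (sym-g zero)) (*P-comm p₀ qₗ))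
  inner : qₗ′ *P y ≈ q₁ *P z
  inner = ≈-sym (continuant-reverse k (init (tail g))
    (λ i → subst (λ j → g (suc (inject₁ i)) ∼ g j) (opposite-suc-inject₁ k i) (sym-g (suc (inject₁ i)))))
  expand : ∀ p₀ q₀ q₁ pₗ qₗ′ qₗ x y z →
    q₀ *P (pₗ *P x +P negP (qₗ′ *P qₗ *P y)) ≈ q₀ *P pₗ *P x +P negP (q₀ *P qₗ *P (qₗ′ *P y))
  expand = solve-∀ ℤ[x]-almost
  factor : ∀ p₀ q₀ q₁ pₗ qₗ′ qₗ x y z →
    qₗ *P p₀ *P x +P negP (q₀ *P qₗ *P (q₁ *P z)) ≈ qₗ *P (p₀ *P x +P negP (q₀ *P q₁ *P z))
  factor = solve-∀ ℤ[x]-almost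

ScaledAtLast : ∀ n → Poly → Vector Pair (suc n) → Vector Pair (suc n) → Set
ScaledAtLast zero    c h′ h = (P (h′ zero) ≈ c *P P (h zero)) × (Q (h′ zero) ≈ c *P Q (h zero))
ScaledAtLast (suc n) c h′ h = (P (h′ zero) ≈ P (h zero)) × (Q (h′ zero) ≈ Q (h zero)) × ScaledAtLast n c (tail h′) (tail h)

continuant-scaledAtLast : ∀ n c (h′ h : Vector Pair (suc n)) → ScaledAtLast n c h′ h →
  continuant (suc n) h′ ≈ c *P continuant (suc n) h
continuant-scaledAtLast zero c h′ h (p≈ , _) = p≈
continuant-scaledAtLast (suc zero) c h′ h (p₀≈ , q₀≈ , p₁≈ , q₁≈) =
  ≈-trans (+P-cong (*P-cong p₀≈ p₁≈) (negP-cong (*P-congʳ oneP (*P-cong q₀≈ q₁≈))))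
          (factor (P (h zero)) (P (h (suc zero))) (Q (h zero)) (Q (h (suc zero))) c)
  where
  factor : ∀ p₀ p₁ q₀ q₁ c → p₀ *P (c *P p₁) +P negP (q₀ *P (c *P q₁) *P oneP) ≈ c *P (p₀ *P p₁ +P negP (q₀ *P q₁ *P oneP))
  factor = solve-∀ ℤ[x]-almost
continuant-scaledAtLast (suc (suc n)) c h′ h (p₀≈ , q₀≈ , rest@(_ , q₁≈ , rest′)) =
  ≈-trans (+P-cong (*P-cong p₀≈ (continuant-scaledAtLast (suc n) c (tail h′) (tail h) rest))
                   (negP-cong (*P-cong (*P-cong q₀≈ q₁≈) (continuant-scaledAtLast n c (tail (tail h′)) (tail (tail h)) rest′))))
          (factor (P (h zero)) (Q (h zero)) (Q (h (suc zero)))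
                  (continuant (suc (suc n)) (tail h)) (continuant (suc n) (tail (tail h))) c)
  where
  factor : ∀ p₀ q₀ q₁ x y c → p₀ *P (c *P x) +P negP (q₀ *P q₁ *P (c *P y)) ≈ c *P (p₀ *P x +P negP (q₀ *P q₁ *P y))
  factor = solve-∀ ℤ[x]-almost

open Chain using (cgraph; first)

-- Rooted products of a path

pair : RootedGraph → Pair
pair G = φ (graph G) , φ (del (graph G) (root G))

φ-rootedProduct : ∀ m (Gs : Vector RootedGraph (suc m)) →
  φ (cgraph (rootedProduct m Gs)) ≈ continuant (suc m) (pair ∘ Gs)
φ-rootedProduct-delFirst : ∀ m (Gs : Vector RootedGraph (suc m)) →
  φ (del (cgraph (rootedProduct m Gs)) (first (rootedProduct m Gs))) ≈ Q (pair (Gs zero)) *P continuant m (pair ∘ tail Gs)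

φ-rootedProduct zero    Gs = ≈-refl
φ-rootedProduct (suc m) Gs =
  ≈-trans (φ-glue (graph (Gs zero)) (root (Gs zero)) (cgraph K) (first K))
  (+P-cong (*P-congˡ (P (pair (Gs zero))) (φ-rootedProduct m (tail Gs)))
           (negP-cong (≈-trans (*P-congˡ (Q (pair (Gs zero))) (φ-rootedProduct-delFirst m (tail Gs)))
                               (≈-sym (*P-assoc (Q (pair (Gs zero))) (Q (pair (Gs (suc zero)))) _)))))
  where K = rootedProduct m (tail Gs)

φ-rootedProduct-delFirst zero    Gs = ≈-sym (*P-identityʳ (Q (pair (Gs zero))))
φ-rootedProduct-delFirst (suc m) Gs =
  ≈-trans (φ-glue-delRoot (graph (Gs zero)) (root (Gs zero)) (cgraph K) (first K))
          (*P-congˡ (Q (pair (Gs zero))) (φ-rootedProduct m (tail Gs)))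
  where K = rootedProduct m (tail Gs)

⊕-delRoot : RootedGraph → RootedGraph → RootedGraph
⊕-delRoot G G′ = record
  { pred  = pred G + pred G′
  ; graph = graph G ⊕ del (graph G′) (root G′)
  ; root  = root G ↑ˡ pred G′ }

mergeLast : ∀ m → Vector RootedGraph (suc (suc m)) → Vector RootedGraph (suc m)
mergeLast zero    Gs zero    = ⊕-delRoot (Gs zero) (Gs (suc zero))
mergeLast (suc m) Gs zero    = Gs zero
mergeLast (suc m) Gs (suc i) = mergeLast m (tail Gs) i

toℕ-first : ∀ m (Gs : Vector RootedGraph (suc m)) → toℕ (first (rootedProduct m Gs)) ≡ toℕ (root (Gs zero))
toℕ-first zero    Gs = refl
toℕ-first (suc m) Gs = FinP.toℕ-↑ˡ (root (Gs zero)) _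

toℕ-root-mergeLast : ∀ m (Gs : Vector RootedGraph (suc (suc m))) → toℕ (root (mergeLast m Gs zero)) ≡ toℕ (root (Gs zero))
toℕ-root-mergeLast zero    Gs = FinP.toℕ-↑ˡ (root (Gs zero)) _
toℕ-root-mergeLast (suc m) Gs = refl

last≢first : ∀ m (Gs : Vector RootedGraph (suc (suc m))) →
  Chain.last (rootedProduct (suc m) Gs) ≢ first (rootedProduct (suc m) Gs)
last≢first m Gs eq = ↑ˡ≢↑ʳ _ _ (sym eq)

toℕ-punchOut-↑ʳ-↑ˡ : ∀ {p b} (x : Fin (suc p)) (y : Fin b) (y≢x : suc p ↑ʳ y ≢ x ↑ˡ b) → toℕ (punchOut y≢x) ≡ toℕ x
toℕ-punchOut-↑ʳ-↑ˡ {p} {b} x y y≢x with toℕ (punchOut y≢x) <? toℕ (suc p ↑ʳ y)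
... | yes lt = trans (sym (toℕ-punchIn-< (suc p ↑ʳ y) (punchOut y≢x) lt)) (trans back (FinP.toℕ-↑ˡ x b))
  where back = cong toℕ (FinP.punchIn-punchOut y≢x)
... | no ge = ⊥-elim (ℕP.<⇒≱ (toℕ-↑ˡ<toℕ-↑ʳ x y) (ℕP.≤-trans (ℕP.≮⇒≥ ge)
    (ℕP.≤-trans (ℕP.n≤1+n _) (ℕP.≤-reflexive (trans (sym (toℕ-punchIn-≥ (suc p ↑ʳ y) (punchOut y≢x) (ℕP.≮⇒≥ ge)))
                                                   (cong toℕ (FinP.punchIn-punchOut y≢x)))))))

del-last-≅ : ∀ m (Gs : Vector RootedGraph (suc (suc m))) →
  del (cgraph (rootedProduct (suc m) Gs)) (Chain.last (rootedProduct (suc m) Gs)) ≅ cgraph (rootedProduct m (mergeLast m Gs))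
del-last-≅ zero Gs =
  DeleteRight.del-glue-≡ (graph (Gs zero)) (root (Gs zero)) (graph (Gs (suc zero))) (root (Gs (suc zero))) (root (Gs (suc zero))) refl
del-last-≅ (suc m) Gs = ≅-trans
  (DeleteRight.del-glue-≢ (graph (Gs zero)) (root (Gs zero)) (cgraph K) (first K) (Chain.last K) (last≢first m (tail Gs)))
  (glue-≅ (graph (Gs zero)) (root (Gs zero)) (del-last-≅ m (tail Gs))
    (trans (toℕ-punchOut-↑ʳ-↑ˡ (root (Gs (suc zero))) (Chain.last K′) (last≢first m (tail Gs)))
           (sym (trans (toℕ-first m (mergeLast m (tail Gs))) (toℕ-root-mergeLast m (tail Gs))))))
  where
  K  = rootedProduct (suc m) (tail Gs)
  K′ = rootedProduct m (tail (tail Gs))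

mergeLast-scaledAtLast : ∀ m (Gs : Vector RootedGraph (suc (suc m))) →
  ScaledAtLast m (Q (pair (last Gs))) (pair ∘ mergeLast m Gs) (init (pair ∘ Gs))
mergeLast-scaledAtLast zero Gs =
    ≈-trans (φ-⊕ H D) (*P-comm (φ H) (φ D))
  , ≈-trans (φ-⊕-delLeft H (root (Gs zero)) D) (*P-comm (φ (del H (root (Gs zero)))) (φ D))
  where
  H = graph (Gs zero)
  D = del (graph (Gs (suc zero))) (root (Gs (suc zero)))
mergeLast-scaledAtLast (suc m) Gs = ≈-refl , ≈-refl , mergeLast-scaledAtLast m (tail Gs)

lemma2p5 : (m : ℕ) (Gs : Fin (suc m) → RootedGraph) →
    (∀ i → αEq (graph (Gs i)) (root (Gs i))
               (graph (Gs (opposite i))) (root (Gs (opposite i)))) →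
    αEq (Chain.cgraph (rootedProduct m Gs)) (Chain.first (rootedProduct m Gs))
        (Chain.cgraph (rootedProduct m Gs)) (Chain.last (rootedProduct m Gs))
lemma2p5 zero    Gs _   _ = refl
lemma2p5 (suc m) Gs sym-α = coeff-≈ (*P-congˡ (φ G) delLast≈delFirst)
  where
  open SetoidReasoning (CommutativeRing.setoid ℤ[x])
  K = rootedProduct (suc m) Gs
  G = cgraph K
  g = pair ∘ Gs
  delLast≈delFirst : φ (del G (Chain.last K)) ≈ φ (del G (first K))
  delLast≈delFirst = begin
    φ (del G (Chain.last K))                         ≈⟨ φ-≅ (del-last-≅ m Gs) ⟩
    φ (cgraph (rootedProduct m (mergeLast m Gs)))    ≈⟨ φ-rootedProduct m (mergeLast m Gs) ⟩
    continuant (suc m) (pair ∘ mergeLast m Gs)       ≈⟨ continuant-scaledAtLast m _ _ (init g) (mergeLast-scaledAtLast m Gs) ⟩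
    Q (last g) *P continuant (suc m) (init g)         ≈⟨ continuant-reverse m g (λ i → mk≈ (sym-α i)) ⟨
    Q (g zero) *P continuant (suc m) (tail g)         ≈⟨ φ-rootedProduct-delFirst (suc m) Gs ⟨
    φ (del G (first K))                              ∎
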